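{- Let $q$ be an odd prime and $p$ an odd prime such that the order of $p$ in $(\mathbb{Z}/q\mathbb{Z})^\times$ is $\ell=(q-1)/2$. Let $L=\mathbb{F}_{p^\ell}$, let $H$ be the group of $q$th roots of unity in $L$, and let $T=\mathrm{tr}_{L/\mathbb{F}_p}(H)\subseteq\mathbb{F}_p$. Let $q^*=q$ if $q\equiv 1\pmod 4$ and $q^*=-q$ if $q\equiv 3\pmod 4$. Then $|T|=2$ if $p\mid (q^*-1)$, and $|T|=3$ otherwise.
   Context: $\mathrm{tr}_{L/\mathbb{F}_p}$ denotes the field trace from $L$ to $\mathbb{F}_p$. -}

module Defs where

open import Level using (0ℓ)
open import Data.Nat using (ℕ; zero; suc; _%_; _≟_)
open import Data.Integer as ℤ using (ℤ; +_; -_)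
open import Data.Bool using (if_then_else_)
open import Data.List using (List; length; filter; upTo)
open import Data.List.Relation.Unary.Any using (Any; any?)
open import Data.List.Relation.Unary.AllPairs using (AllPairs)
open import Data.Product using (∃; _×_)
open import Relation.Nullary using (¬_; Dec; does)
open import Relation.Nullary.Decidable using (_×-dec_)
open import Relation.Binary.Definitions using (Decidable)
open import Algebra.Bundles using (CommutativeRing)

record FiniteField : Set₁ where
  field
    ring : CommutativeRing 0ℓ 0ℓ
  open CommutativeRing ring
  field
    _≈?_     : Decidable _≈_
    0≉1      : ¬ (0# ≈ 1#)
    inverse  : ∀ x → ¬ (x ≈ 0#) → ∃ λ y → (x * y) ≈ 1#
    elems    : List Carrier
    complete : ∀ x → Any (x ≈_) elems
    distinct : AllPairs (λ x y → ¬ (x ≈ y)) elems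

card : FiniteField → ℕ
card L = length (FiniteField.elems L)

module _ (L : FiniteField) where
  open FiniteField L
  open CommutativeRing ring

  pow : Carrier → ℕ → Carrier
  pow x zero    = 1#
  pow x (suc n) = x * pow x n

  natL : ℕ → Carrier
  natL zero    = 0#
  natL (suc n) = 1# + natL n

  trace : ℕ → ℕ → Carrier → Carrier
  trace p zero    x = 0#
  trace p (suc k) x = x + trace p k (pow x p)

  -- k ∈ T = tr(H), where H = {x ∈ L | x^q = 1}; F_p is identified with
  -- {natL k | k < p}
  inT? : (p ℓ q k : ℕ) → Dec (Any (λ x → (pow x q ≈ 1#) × (trace p ℓ x ≈ natL k)) elems)
  inT? p ℓ q k = any? (λ x → (pow x q ≈? 1#) ×-dec (trace p ℓ x ≈? natL k)) elems

  cardT : (p ℓ q : ℕ) → ℕ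
  cardT p ℓ q = length (filter (inT? p ℓ q) (upTo p))

-- q* = q if q ≡ 1 mod 4, and -q otherwise (i.e. q ≡ 3 mod 4 for odd q)
qStar : ℕ → ℤ
qStar q = if does (q % 4 ≟ 1) then + q else - (+ q)

{-# OPTIONS --safe #-}
module Submission where

-- Let x be a primitive q-th root of unity in L. As p has order ℓ = (q-1)/2 modulo q, the
-- powers of p form the index-2 subgroup P of (ℤ/q)ˣ, so the trace of x^a is the Gauss period
-- ∑_{b ∈ aP} x^b, and it lies in 𝔽_p because it is fixed by the Frobenius. The two periods
-- t₁, t₂ satisfy t₁ + t₂ = -1 and (t₁ - t₂)² = g² = χ(-1) q, where g = ∑ χ(a) x^a is the
-- quadratic Gauss sum; hence every nontrivial q-th root of unity has trace t₁ or t₂, and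
-- t₁ ≠ t₂ because p ∤ q. Together with tr(1) = ℓ this gives T = {ℓ, t₁, t₂}, and ℓ is one of
-- the periods iff (2ℓ+1)² = χ(-1) q, i.e. iff q = χ(-1) = q*/q in 𝔽_p, i.e. iff p ∣ q* - 1.

open import Algebra.Bundles using (CommutativeRing; CommutativeMonoid)
open import Relation.Binary.Bundles using (Setoid)
open import Data.Nat using (ℕ; NonZero)
import Data.Nat as ℕ
open import Data.Nat.Primality using (Prime)
open import Relation.Binary.PropositionalEquality using (_≡_)
open import Defs using (FiniteField; card; pow; natL; trace; inT?; cardT; qStar)

module IntegerCoefficientSolver {c ℓ} (R : CommutativeRing c ℓ) where

  open import Data.Nat as ℕ using (zero; suc)
  import Data.Nat.Properties as ℕ
  open import Data.Integer as ℤ using (ℤ; +_; -[1+_]; _⊖_)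
  import Data.Integer.Properties as ℤ
  open import Data.Sign as Sign using ()
  open import Data.Maybe using (Maybe; just; nothing)
  open import Relation.Binary.PropositionalEquality as ≡ using (_≡_)
  open import Relation.Nullary using (yes; no)
  import Algebra.Solver.Ring.AlmostCommutativeRing as ACR

  open CommutativeRing R
  open import Relation.Binary.Reasoning.Setoid setoid
  open import Algebra.Properties.Ring ring
    using (-‿involutive; -0#≈0#; -‿distribˡ-*; -‿distribʳ-*; -‿+-comm)
  open import Algebra.Properties.CommutativeSemigroup +-commutativeSemigroup using (interchange)
  open import Algebra.Properties.Semiring.Mult.TCOptimised semiring using (_×_; 1+×; ×-homo-+; ×1-homo-*)

  -- The optimised multiplication makes fromℕ 1 reduce to 1#, so the integer constants
  -- of the solver below are definitionally the ring constants they stand for.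
  fromℕ : ℕ → Carrier
  fromℕ n = n × 1#

  fromℕ-suc : ∀ n → fromℕ (suc n) ≈ 1# + fromℕ n
  fromℕ-suc n = 1+× n 1#

  fromℕ-+ : ∀ m n → fromℕ (m ℕ.+ n) ≈ fromℕ m + fromℕ n
  fromℕ-+ m n = ×-homo-+ 1# m n

  fromℕ-* : ∀ m n → fromℕ (m ℕ.* n) ≈ fromℕ m * fromℕ n
  fromℕ-* = ×1-homo-*

  fromℤ : ℤ → Carrier
  fromℤ (+ n)    = fromℕ n
  fromℤ -[1+ n ] = - fromℕ (suc n)

  fromℤ-⊖ : ∀ m n → fromℤ (m ⊖ n) ≈ fromℕ m - fromℕ n
  fromℤ-⊖ m       zero    = trans (sym (+-identityʳ _)) (+-congˡ (sym -0#≈0#))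
  fromℤ-⊖ zero    (suc n) = sym (+-identityˡ _)
  fromℤ-⊖ (suc m) (suc n) = begin
    fromℤ (suc m ⊖ suc n)                     ≡⟨ ≡.cong fromℤ (ℤ.[1+m]⊖[1+n]≡m⊖n m n) ⟩
    fromℤ (m ⊖ n)                             ≈⟨ fromℤ-⊖ m n ⟩
    fromℕ m - fromℕ n                         ≈⟨ +-identityˡ _ ⟨
    0# + (fromℕ m - fromℕ n)                  ≈⟨ +-congʳ (-‿inverseʳ 1#) ⟨
    (1# - 1#) + (fromℕ m - fromℕ n)           ≈⟨ interchange 1# (- 1#) (fromℕ m) (- fromℕ n) ⟩
    (1# + fromℕ m) + (- 1# - fromℕ n)         ≈⟨ +-cong (fromℕ-suc m) (sym (-‿+-comm 1# (fromℕ n))) ⟨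
    fromℕ (suc m) - (1# + fromℕ n)            ≈⟨ +-congˡ (-‿cong (fromℕ-suc n)) ⟨
    fromℕ (suc m) - fromℕ (suc n)             ∎

  fromℤ-neg : ∀ i → fromℤ (ℤ.- i) ≈ - fromℤ i
  fromℤ-neg (+ zero)  = sym -0#≈0#
  fromℤ-neg (+ suc n) = refl
  fromℤ-neg -[1+ n ]  = sym (-‿involutive _)

  fromℤ-+ : ∀ i j → fromℤ (i ℤ.+ j) ≈ fromℤ i + fromℤ j
  fromℤ-+ -[1+ m ] -[1+ n ] = begin
    - fromℕ (suc (suc (m ℕ.+ n)))     ≡⟨ ≡.cong (λ k → - fromℕ (suc k)) (ℕ.+-suc m n) ⟨
    - fromℕ (suc m ℕ.+ suc n)         ≈⟨ -‿cong (fromℕ-+ (suc m) (suc n)) ⟩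
    - (fromℕ (suc m) + fromℕ (suc n)) ≈⟨ -‿+-comm _ _ ⟨
    - fromℕ (suc m) - fromℕ (suc n)   ∎
  fromℤ-+ -[1+ m ] (+ n)    = trans (fromℤ-⊖ n (suc m)) (+-comm _ _)
  fromℤ-+ (+ m)    -[1+ n ] = fromℤ-⊖ m (suc n)
  fromℤ-+ (+ m)    (+ n)    = fromℕ-+ m n

  fromℤ-+◃ : ∀ n → fromℤ (Sign.+ ℤ.◃ n) ≈ fromℕ n
  fromℤ-+◃ zero    = refl
  fromℤ-+◃ (suc n) = refl

  fromℤ--◃ : ∀ n → fromℤ (Sign.- ℤ.◃ n) ≈ - fromℕ n
  fromℤ--◃ zero    = sym -0#≈0#
  fromℤ--◃ (suc n) = refl

  fromℤ-* : ∀ i j → fromℤ (i ℤ.* j) ≈ fromℤ i * fromℤ j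
  fromℤ-* (+ m)    (+ n)    = trans (fromℤ-+◃ (m ℕ.* n)) (fromℕ-* m n)
  fromℤ-* (+ m)    -[1+ n ] = trans (fromℤ--◃ (m ℕ.* suc n))
    (trans (-‿cong (fromℕ-* m (suc n))) (-‿distribʳ-* _ _))
  fromℤ-* -[1+ m ] (+ n)    = trans (fromℤ--◃ (suc m ℕ.* n))
    (trans (-‿cong (fromℕ-* (suc m) n)) (-‿distribˡ-* _ _))
  fromℤ-* -[1+ m ] -[1+ n ] = begin
    fromℤ (Sign.+ ℤ.◃ (suc m ℕ.* suc n))  ≈⟨ fromℤ-+◃ (suc m ℕ.* suc n) ⟩
    fromℕ (suc m ℕ.* suc n)               ≈⟨ fromℕ-* (suc m) (suc n) ⟩
    fromℕ (suc m) * fromℕ (suc n)         ≈⟨ -‿involutive _ ⟨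
    - - (fromℕ (suc m) * fromℕ (suc n))   ≈⟨ -‿cong (-‿distribˡ-* _ _) ⟩
    - (- fromℕ (suc m) * fromℕ (suc n))   ≈⟨ -‿distribʳ-* _ _ ⟩
    - fromℕ (suc m) * - fromℕ (suc n)     ∎

  fromℤ-homomorphism : ℤ.+-*-rawRing ACR.-Raw-AlmostCommutative⟶ ACR.fromCommutativeRing R
  fromℤ-homomorphism = record
    { ⟦_⟧    = fromℤ
    ; +-homo = fromℤ-+
    ; *-homo = fromℤ-*
    ; -‿homo = fromℤ-neg
    ; 0-homo = refl
    ; 1-homo = refl
    }

  fromℤ-≟ : ∀ i j → Maybe (fromℤ i ≈ fromℤ j)
  fromℤ-≟ i j with i ℤ.≟ j
  ... | yes ≡.refl = just refl
  ... | no _       = nothing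

  open import Algebra.Solver.Ring ℤ.+-*-rawRing (ACR.fromCommutativeRing R) fromℤ-homomorphism fromℤ-≟ public
    using (Polynomial; solve; con; _:+_; _:-_; _:*_; :-_; _:=_)

  :0 :1 : ∀ {n} → Polynomial n
  :0 = con (+ 0)
  :1 = con (+ 1)

module ListSum {c ℓ} (M : CommutativeMonoid c ℓ) where

  open import Data.List using (List; []; _∷_; _++_; map; foldr; applyUpTo; upTo)
  open import Data.List.Properties using (map-applyUpTo)
  open import Relation.Binary.PropositionalEquality as ≡ using (_≡_)
  open import Data.List.Relation.Unary.All using (All; []; _∷_)
  open import Relation.Binary.Core using (_Preserves_⟶_)
  import Data.List.Relation.Binary.Permutation.Setoid as Permutation
  import Data.List.Relation.Binary.Permutation.Setoid.Properties as PermutationProperties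
  open import Function using (_∘_; id)

  open CommutativeMonoid M
  open import Relation.Binary.Reasoning.Setoid setoid
  open import Algebra.Properties.CommutativeSemigroup commutativeSemigroup using (interchange)

  ∑ : ∀ {a} {A : Set a} → (A → Carrier) → List A → Carrier
  ∑ f xs = foldr _∙_ ε (map f xs)

  module _ {a} {A : Set a} where

    ∑-cong-All : ∀ {f g : A → Carrier} xs → All (λ x → f x ≈ g x) xs → ∑ f xs ≈ ∑ g xs
    ∑-cong-All []       []         = refl
    ∑-cong-All (x ∷ xs) (fx≈gx ∷ h) = ∙-cong fx≈gx (∑-cong-All xs h)

    ∑-cong : ∀ {f g : A → Carrier} xs → (∀ x → f x ≈ g x) → ∑ f xs ≈ ∑ g xs
    ∑-cong []       h = refl
    ∑-cong (x ∷ xs) h = ∙-cong (h x) (∑-cong xs h)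

    ∑-++ : ∀ (f : A → Carrier) xs ys → ∑ f (xs ++ ys) ≈ ∑ f xs ∙ ∑ f ys
    ∑-++ f []       ys = sym (identityˡ _)
    ∑-++ f (x ∷ xs) ys = trans (∙-congˡ (∑-++ f xs ys)) (sym (assoc _ _ _))

    ∑-∙ : ∀ (f g : A → Carrier) xs → ∑ (λ x → f x ∙ g x) xs ≈ ∑ f xs ∙ ∑ g xs
    ∑-∙ f g []       = sym (identityˡ ε)
    ∑-∙ f g (x ∷ xs) = trans (∙-congˡ (∑-∙ f g xs)) (interchange _ _ _ _)

    ∑-ε : ∀ (xs : List A) → ∑ (λ _ → ε) xs ≈ ε
    ∑-ε []       = refl
    ∑-ε (x ∷ xs) = trans (identityˡ _) (∑-ε xs)

  ∑-applyUpTo : ∀ {a} {A : Set a} (f : A → Carrier) g n → ∑ f (applyUpTo g n) ≡ ∑ (f ∘ g) (upTo n)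
  ∑-applyUpTo f g n =
    ≡.cong (foldr _∙_ ε) (≡.trans (map-applyUpTo g f n) (≡.sym (map-applyUpTo id (f ∘ g) n)))

  ∑-map : ∀ {a b} {A : Set a} {B : Set b} (f : B → Carrier) (g : A → B) xs → ∑ f (map g xs) ≈ ∑ (f ∘ g) xs
  ∑-map f g []       = refl
  ∑-map f g (x ∷ xs) = ∙-congˡ (∑-map f g xs)

  ∑-swap : ∀ {a b} {A : Set a} {B : Set b} (F : A → B → Carrier) xs ys →
           ∑ (λ x → ∑ (F x) ys) xs ≈ ∑ (λ y → ∑ (λ x → F x y) xs) ys
  ∑-swap F []       ys = sym (∑-ε ys)
  ∑-swap F (x ∷ xs) ys = trans (∙-congˡ (∑-swap F xs ys)) (sym (∑-∙ (F x) _ ys))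

  module _ {a r} (S : Setoid a r) where
    open Setoid S using () renaming (Carrier to A; _≈_ to _≈ₛ_)
    open Permutation S using (_↭_)

    ∑-↭ : ∀ {f : A → Carrier} → f Preserves _≈ₛ_ ⟶ _≈_ → ∀ {xs ys} → xs ↭ ys → ∑ f xs ≈ ∑ f ys
    ∑-↭ f-cong xs↭ys = PermutationProperties.foldr-commMonoid setoid isCommutativeMonoid
      (PermutationProperties.map⁺ S setoid f-cong xs↭ys)

module RingListSum {c ℓ} (R : CommutativeRing c ℓ) where

  open import Data.List using (List; []; _∷_; length)

  open CommutativeRing R
  open IntegerCoefficientSolver R using (fromℕ; fromℕ-suc)
  open ListSum +-commutativeMonoid public
  open import Algebra.Properties.Ring ring using (-0#≈0#; -‿+-comm)

  module _ {a} {A : Set a} where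

    ∑-*ˡ : ∀ k (f : A → Carrier) xs → ∑ (λ x → k * f x) xs ≈ k * ∑ f xs
    ∑-*ˡ k f []       = sym (zeroʳ k)
    ∑-*ˡ k f (x ∷ xs) = trans (+-congˡ (∑-*ˡ k f xs)) (sym (distribˡ _ _ _))

    ∑-*ʳ : ∀ k (f : A → Carrier) xs → ∑ (λ x → f x * k) xs ≈ ∑ f xs * k
    ∑-*ʳ k f xs = trans (∑-cong xs (λ x → *-comm (f x) k)) (trans (∑-*ˡ k f xs) (*-comm k _))

    ∑-‿ : ∀ (f : A → Carrier) xs → ∑ (λ x → - f x) xs ≈ - ∑ f xs
    ∑-‿ f []       = sym -0#≈0#
    ∑-‿ f (x ∷ xs) = trans (+-congˡ (∑-‿ f xs)) (-‿+-comm _ _)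

    ∑-const : ∀ k (xs : List A) → ∑ (λ _ → k) xs ≈ fromℕ (length xs) * k
    ∑-const k []       = sym (zeroˡ k)
    ∑-const k (x ∷ xs) = begin
      k + ∑ (λ _ → k) xs             ≈⟨ +-cong (sym (*-identityˡ k)) (∑-const k xs) ⟩
      1# * k + fromℕ (length xs) * k ≈⟨ distribʳ k 1# _ ⟨
      (1# + fromℕ (length xs)) * k   ≈⟨ *-congʳ (fromℕ-suc (length xs)) ⟨
      fromℕ (length (x ∷ xs)) * k    ∎
      where open import Relation.Binary.Reasoning.Setoid setoid

  ∑-* : ∀ {a b} {A : Set a} {B : Set b} (f : A → Carrier) (g : B → Carrier) xs ys →
        ∑ f xs * ∑ g ys ≈ ∑ (λ x → ∑ (λ y → f x * g y) ys) xs
  ∑-* f g []       ys = zeroˡ _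
  ∑-* f g (x ∷ xs) ys = trans (distribʳ _ _ _) (+-cong (sym (∑-*ˡ (f x) g ys)) (∑-* f g xs ys))

module UniqueSublist {a ℓ} (S : Setoid a ℓ) where

  open import Data.Nat using (_+_; _≤_; _<_; s≤s; z≤n)
  open import Data.Empty using (⊥-elim)
  import Data.Nat.Properties as ℕ
  open import Data.List using (List; []; _∷_; _++_; length; map)
  open import Data.List.Properties using (length-++; ++-identityʳ; length-map)
  open import Data.List.Relation.Unary.Any as Any using (here; there)
  open import Data.List.Relation.Unary.All.Properties using (All¬⇒¬Any)
  open import Data.List.Relation.Unary.AllPairs as AllPairs using (_∷_)
  import Data.List.Relation.Unary.AllPairs.Properties as AllPairs
  open import Data.List.Membership.Setoid S using (_∈_)
  open import Data.List.Membership.Setoid.Properties using (∈-∃++; ∈-map⁻; ∈-resp-≈)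
  open import Data.List.Relation.Unary.Unique.Setoid S using (Unique)
  open import Data.List.Relation.Binary.Subset.Setoid S using (_⊆_)
  open import Data.List.Relation.Binary.Permutation.Setoid S
    using (_↭_; ↭-refl; ↭-trans; ↭-reflexive; ↭-reflexive-≋; prep)
  open import Data.List.Relation.Binary.Permutation.Setoid.Properties S
    using (shift; ∈-resp-↭; xs↭ys⇒|xs|≡|ys|)
  open import Data.Product using (∃; _,_)
  open import Relation.Binary.PropositionalEquality as ≡ using (_≡_)

  open Setoid S

  ⊆-complement : ∀ {xs ys} → Unique xs → xs ⊆ ys → ∃ λ zs → ys ↭ xs ++ zs
  ⊆-complement {[]}     {ys} _ _ = ys , ↭-refl
  ⊆-complement {x ∷ xs} {ys} (x∉xs ∷ xs!) xs⊆ys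
    with as , bs , w , x≈w , ys≋ ← ∈-∃++ S (xs⊆ys (here refl)) =
    let zs , rest↭ = ⊆-complement xs! xs⊆rest
    in  zs , ↭-trans ys↭ (prep (sym x≈w) rest↭)
    where
    ys↭ : ys ↭ w ∷ as ++ bs
    ys↭ = ↭-trans (↭-reflexive-≋ ys≋) (shift refl as bs)
    xs⊆rest : xs ⊆ as ++ bs
    xs⊆rest {y} y∈xs with ∈-resp-↭ ys↭ (xs⊆ys (there y∈xs))
    ... | here y≈w = ⊥-elim (All¬⇒¬Any x∉xs (Any.map (trans (trans x≈w (sym y≈w))) y∈xs))
    ... | there y∈ = y∈

  length-↭++ : ∀ {ys} xs zs → ys ↭ xs ++ zs → length ys ≡ length xs + length zs
  length-↭++ xs zs ys↭ = ≡.trans (xs↭ys⇒|xs|≡|ys| ys↭) (length-++ xs)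

  unique⊆⇒length≤ : ∀ {xs ys} → Unique xs → xs ⊆ ys → length xs ≤ length ys
  unique⊆⇒length≤ {xs} xs! xs⊆ys with zs , ys↭ ← ⊆-complement xs! xs⊆ys =
    ℕ.≤-trans (ℕ.m≤m+n (length xs) (length zs)) (ℕ.≤-reflexive (≡.sym (length-↭++ xs zs ys↭)))

  unique⊆-length⇒↭ : ∀ {xs ys} → Unique xs → xs ⊆ ys → length ys ≤ length xs → ys ↭ xs
  unique⊆-length⇒↭ {xs} {ys} xs! xs⊆ys ys≤xs with ⊆-complement xs! xs⊆ys
  ... | [] , ys↭ = ↭-trans ys↭ (↭-reflexive (++-identityʳ xs))
  ... | z ∷ zs , ys↭ = ⊥-elim (ℕ.<-irrefl ≡.refl (ℕ.≤-trans xs<ys ys≤xs))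
    where
    xs<ys : length xs < length ys
    xs<ys = ℕ.≤-trans (ℕ.m<m+n (length xs) (s≤s z≤n))
                      (ℕ.≤-reflexive (≡.sym (length-↭++ xs (z ∷ zs) ys↭)))

  self-injection⇒↭ : ∀ {f xs} → (∀ {x y} → f x ≈ f y → x ≈ y) → Unique xs →
                      (∀ {x} → x ∈ xs → f x ∈ xs) → xs ↭ map f xs
  self-injection⇒↭ {f} {xs} f-injective xs! f-closed =
    unique⊆-length⇒↭ fxs! fxs⊆xs (ℕ.≤-reflexive (≡.sym (length-map f xs)))
    where
    fxs! : Unique (map f xs)
    fxs! = AllPairs.map⁺ (AllPairs.map (λ x≉y fx≈fy → x≉y (f-injective fx≈fy)) xs!)
    fxs⊆xs : map f xs ⊆ xs
    fxs⊆xs v∈fxs with x , x∈xs , v≈fx ← ∈-map⁻ S S v∈fxs = ∈-resp-≈ S (sym v≈fx) (f-closed x∈xs)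

module FiniteFieldProperties (L : FiniteField) where

  open import Data.Nat as ℕ using (ℕ; zero; suc; _∸_; _≤_; _<_; z≤n; s≤s)
  import Data.Nat.Properties as ℕ
  open import Data.Nat.Divisibility using (_∣_; divides)
  open import Data.List using (List; []; _∷_; length; map; filter; upTo) renaming (_++_ to _++ₗ_)
  open import Data.List.Properties using (upTo-∷ʳ)
  open import Data.List.Relation.Unary.All as All using (All; []; _∷_)
  import Data.List.Relation.Unary.All.Properties as All
  open import Data.List.Relation.Unary.Any as Any using (Any; here; there)
  open import Data.List.Relation.Unary.AllPairs using ([]; _∷_)
  import Data.List.Relation.Unary.AllPairs.Properties as AllPairs
  open import Data.Vec using (Vec; []; _∷_; _++_; replicate)
  open import Data.Product using (∃; _×_; _,_; proj₁; proj₂)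
  open import Data.Sum using (_⊎_; inj₁; inj₂)
  open import Data.Empty using (⊥; ⊥-elim)
  open import Function using (id; _∘_)
  open import Relation.Nullary using (¬_; Dec; yes; no; ¬?)
  open import Relation.Binary.PropositionalEquality as ≡ using (_≡_)

  open FiniteField L
  open CommutativeRing ring hiding (ring)
  open IntegerCoefficientSolver ring
  open RingListSum ring using (∑; ∑-∙; ∑-const; ∑-↭; ∑-map; ∑-++)
  open UniqueSublist setoid
  open import Data.List.Membership.Setoid setoid using (_∈_)
  open import Data.List.Membership.Setoid.Properties using (∈-filter⁺)
  open import Data.List.Relation.Unary.Unique.Setoid setoid using (Unique)
  open import Data.List.Relation.Binary.Subset.Setoid setoid using (_⊆_)
  open import Algebra.Properties.Ring (CommutativeRing.ring ring)
    using (x≈y⇒x∙y⁻¹≈ε; x∙y⁻¹≈ε⇒x≈y; -‿involutive; +-cancelˡ; +-identityˡ-unique)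
  open import Algebra.Properties.Semiring.Exp semiring public using (_^_; ^-congˡ; ^-homo-*; ^-assocʳ)
  open import Relation.Binary.Reasoning.Setoid setoid

  CharacteristicDivides : ℕ → Set
  CharacteristicDivides n = fromℕ n ≈ 0#

  pow≡^ : ∀ x n → pow L x n ≡ x ^ n
  pow≡^ x zero    = ≡.refl
  pow≡^ x (suc n) = ≡.cong (x *_) (pow≡^ x n)

  natL≈fromℕ : ∀ n → natL L n ≈ fromℕ n
  natL≈fromℕ zero    = refl
  natL≈fromℕ (suc n) = trans (+-congˡ (natL≈fromℕ n)) (sym (fromℕ-suc n))

  1^n≈1 : ∀ n → 1# ^ n ≈ 1#
  1^n≈1 zero    = refl
  1^n≈1 (suc n) = trans (*-identityˡ _) (1^n≈1 n)

  fromℕ-^ : ∀ m n → fromℕ (m ℕ.^ n) ≈ fromℕ m ^ n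
  fromℕ-^ m zero    = refl
  fromℕ-^ m (suc n) = trans (fromℕ-* m (m ℕ.^ n)) (*-congˡ (fromℕ-^ m n))

  *-cancelˡ-nonzero : ∀ {x y z} → ¬ x ≈ 0# → x * y ≈ x * z → y ≈ z
  *-cancelˡ-nonzero {x} {y} {z} x≉0 xy≈xz with x⁻¹ , xx⁻¹≈1 ← inverse x x≉0 = begin
    y                 ≈⟨ *-identityˡ y ⟨
    1# * y            ≈⟨ *-congʳ xx⁻¹≈1 ⟨
    (x * x⁻¹) * y     ≈⟨ solve 3 (λ x x⁻¹ y → (x :* x⁻¹) :* y := x⁻¹ :* (x :* y)) refl x x⁻¹ y ⟩
    x⁻¹ * (x * y)     ≈⟨ *-congˡ xy≈xz ⟩
    x⁻¹ * (x * z)     ≈⟨ solve 3 (λ x x⁻¹ z → x⁻¹ :* (x :* z) := (x :* x⁻¹) :* z) refl x x⁻¹ z ⟩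
    (x * x⁻¹) * z     ≈⟨ *-congʳ xx⁻¹≈1 ⟩
    1# * z            ≈⟨ *-identityˡ z ⟩
    z                 ∎

  *≈0⇒≈0 : ∀ {x y} → ¬ x ≈ 0# → x * y ≈ 0# → y ≈ 0#
  *≈0⇒≈0 {x} x≉0 xy≈0 = *-cancelˡ-nonzero x≉0 (trans xy≈0 (sym (zeroʳ x)))

  nonzero-* : ∀ {x y} → ¬ x ≈ 0# → ¬ y ≈ 0# → ¬ x * y ≈ 0#
  nonzero-* x≉0 y≉0 xy≈0 = y≉0 (*≈0⇒≈0 x≉0 xy≈0)

  nonzero-^ : ∀ {x} n → ¬ x ≈ 0# → ¬ x ^ n ≈ 0#
  nonzero-^ zero    x≉0 1≈0 = 0≉1 (sym 1≈0)
  nonzero-^ (suc n) x≉0     = nonzero-* x≉0 (nonzero-^ n x≉0)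

  ^≈0⇒≈0 : ∀ {x} n → x ^ n ≈ 0# → x ≈ 0#
  ^≈0⇒≈0 {x} n xⁿ≈0 with x ≈? 0#
  ... | yes x≈0 = x≈0
  ... | no  x≉0 = ⊥-elim (nonzero-^ n x≉0 xⁿ≈0)

  x²≈y²⇒x≈±y : ∀ {x y} → x * x ≈ y * y → x ≈ y ⊎ x ≈ - y
  x²≈y²⇒x≈±y {x} {y} x²≈y² with (x - y) ≈? 0# | (x + y) ≈? 0#
  ... | yes x-y≈0 | _         = inj₁ (x∙y⁻¹≈ε⇒x≈y x y x-y≈0)
  ... | no  _     | yes x+y≈0 = inj₂ (x∙y⁻¹≈ε⇒x≈y x (- y) (trans (+-congˡ (-‿involutive y)) x+y≈0))
  ... | no  x-y≉0 | no  x+y≉0 = ⊥-elim (nonzero-* x-y≉0 x+y≉0 (begin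
    (x - y) * (x + y) ≈⟨ solve 2 (λ x y → (x :- y) :* (x :+ y) := x :* x :- y :* y) refl x y ⟩
    x * x - y * y     ≈⟨ x≈y⇒x∙y⁻¹≈ε x²≈y² ⟩
    0#                ∎))

  geometric-sum : ∀ y n → (y - 1#) * ∑ (y ^_) (upTo n) ≈ y ^ n - 1#
  geometric-sum y zero    = trans (zeroʳ _) (sym (-‿inverseʳ 1#))
  geometric-sum y (suc n) = begin
    (y - 1#) * ∑ (y ^_) (upTo (suc n))                 ≡⟨ ≡.cong (λ xs → (y - 1#) * ∑ (y ^_) xs) (upTo-∷ʳ n) ⟨
    (y - 1#) * ∑ (y ^_) (upTo n ++ₗ n ∷ [])            ≈⟨ *-congˡ (∑-++ (y ^_) (upTo n) (n ∷ [])) ⟩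
    (y - 1#) * (∑ (y ^_) (upTo n) + (y ^ n + 0#))
      ≈⟨ solve 3 (λ y G w → (y :- :1) :* (G :+ (w :+ :0)) := (y :- :1) :* G :+ (y :* w :- w)) refl y _ (y ^ n) ⟩
    (y - 1#) * ∑ (y ^_) (upTo n) + (y * y ^ n - y ^ n) ≈⟨ +-congʳ (geometric-sum y n) ⟩
    (y ^ n - 1#) + (y * y ^ n - y ^ n)                 ≈⟨ solve 2 (λ y w → (w :- :1) :+ (y :* w :- w) := y :* w :- :1) refl y (y ^ n) ⟩
    y * y ^ n - 1#                                     ∎

  -- monic as z evaluates, by Horner's rule, the monic polynomial of degree n whose
  -- lower coefficients are as, constant term first.
  monic : ∀ {n} → Vec Carrier n → Carrier → Carrier
  monic []       z = 1#
  monic (a ∷ as) z = a + z * monic as z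

  divide : ∀ {n} → Vec Carrier (suc n) → Carrier → Vec Carrier n
  divide (a ∷ [])     r = []
  divide (a ∷ b ∷ as) r = monic (b ∷ as) r ∷ divide (b ∷ as) r

  monic-divide : ∀ {n} (f : Vec Carrier (suc n)) r z → monic f z ≈ (z - r) * monic (divide f r) z + monic f r
  monic-divide (a ∷ [])     r z =
    solve 3 (λ a r z → a :+ z :* :1 := (z :- r) :* :1 :+ (a :+ r :* :1)) refl a r z
  monic-divide (a ∷ b ∷ as) r z = begin
    a + z * monic (b ∷ as) z
      ≈⟨ +-congˡ (*-congˡ (monic-divide (b ∷ as) r z)) ⟩
    a + z * ((z - r) * monic (divide (b ∷ as) r) z + monic (b ∷ as) r)
      ≈⟨ solve 5 (λ a z r q g → a :+ z :* ((z :- r) :* q :+ g) := (z :- r) :* (g :+ z :* q) :+ (a :+ r :* g))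
               refl a z r (monic (divide (b ∷ as) r) z) (monic (b ∷ as) r) ⟩
    (z - r) * (monic (b ∷ as) r + z * monic (divide (b ∷ as) r) z) + (a + r * monic (b ∷ as) r) ∎

  monic-roots≤degree : ∀ {n} (f : Vec Carrier n) {rs} → Unique rs → All (λ r → monic f r ≈ 0#) rs → length rs ≤ n
  monic-roots≤degree f          {[]}     _            _              = z≤n
  monic-roots≤degree []         {r ∷ rs} _            (1≈0 ∷ _)      = ⊥-elim (0≉1 (sym 1≈0))
  monic-roots≤degree f@(_ ∷ _) {r ∷ rs} (r∉rs ∷ rs!) (fr≈0 ∷ frs≈0) =
    s≤s (monic-roots≤degree (divide f r) rs! (All.zipWith root-of-quotient (r∉rs , frs≈0)))
    where
    root-of-quotient : ∀ {s} → ¬ r ≈ s × monic f s ≈ 0# → monic (divide f r) s ≈ 0#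
    root-of-quotient {s} (r≉s , fs≈0) = *≈0⇒≈0 s-r≉0 (begin
      (s - r) * monic (divide f r) s                ≈⟨ +-identityʳ _ ⟨
      (s - r) * monic (divide f r) s + 0#           ≈⟨ +-congˡ fr≈0 ⟨
      (s - r) * monic (divide f r) s + monic f r    ≈⟨ monic-divide f r s ⟨
      monic f s                                     ≈⟨ fs≈0 ⟩
      0#                                            ∎)
      where
      s-r≉0 : ¬ s - r ≈ 0#
      s-r≉0 s-r≈0 = r≉s (sym (x∙y⁻¹≈ε⇒x≈y s r s-r≈0))

  xᵐ⁺¹⁺ⁿ-xᵐ : ∀ m n → Vec Carrier (m ℕ.+ suc n)
  xᵐ⁺¹⁺ⁿ-xᵐ m n = replicate m 0# ++ (- 1# ∷ replicate n 0#)

  monic-xᵐ⁺¹⁺ⁿ-xᵐ : ∀ m n z → monic (xᵐ⁺¹⁺ⁿ-xᵐ m n) z ≈ z ^ (m ℕ.+ suc n) - z ^ m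
  monic-xᵐ⁺¹⁺ⁿ-xᵐ m n z = begin
    monic (replicate m 0# ++ (- 1# ∷ replicate n 0#)) z ≈⟨ monic-0ᵐ++ m _ ⟩
    z ^ m * (- 1# + z * monic (replicate n 0#) z)      ≈⟨ *-congˡ (+-congˡ (*-congˡ (monic-0ⁿ n))) ⟩
    z ^ m * (- 1# + z * z ^ n)                         ≈⟨ solve 2 (λ a b → a :* (:- :1 :+ b) := a :* b :- a) refl (z ^ m) (z ^ suc n) ⟩
    z ^ m * z ^ suc n - z ^ m                          ≈⟨ +-congʳ (^-homo-* z m (suc n)) ⟨
    z ^ (m ℕ.+ suc n) - z ^ m                          ∎
    where
    monic-0ⁿ : ∀ n → monic (replicate n 0#) z ≈ z ^ n
    monic-0ⁿ zero    = refl
    monic-0ⁿ (suc n) = trans (+-identityˡ _) (*-congˡ (monic-0ⁿ n))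
    monic-0ᵐ++ : ∀ {k} m (v : Vec Carrier k) → monic (replicate m 0# ++ v) z ≈ z ^ m * monic v z
    monic-0ᵐ++ zero    v = sym (*-identityˡ _)
    monic-0ᵐ++ (suc m) v = trans (+-identityˡ _) (trans (*-congˡ (monic-0ᵐ++ m v)) (sym (*-assoc _ _ _)))

  xⁿ≈xᵐ-solutions≤n : ∀ {m n rs} → m < n → Unique rs → All (λ r → r ^ n ≈ r ^ m) rs → length rs ≤ n
  xⁿ≈xᵐ-solutions≤n {m} {n} {rs} m<n rs! sols = ≡.subst (length rs ≤_) m+[1+k]≡n
    (monic-roots≤degree (xᵐ⁺¹⁺ⁿ-xᵐ m k) rs!
      (All.map (λ {r} rⁿ≈rᵐ → trans (monic-xᵐ⁺¹⁺ⁿ-xᵐ m k r) (x≈y⇒x∙y⁻¹≈ε rⁿ≈rᵐ))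
      (≡.subst (λ e → All (λ r → r ^ e ≈ r ^ m) rs) (≡.sym m+[1+k]≡n) sols)))
    where
    k = n ∸ suc m
    m+[1+k]≡n : m ℕ.+ suc k ≡ n
    m+[1+k]≡n = ≡.trans (ℕ.+-suc m k) (ℕ.m+[n∸m]≡n m<n)

  char∣card : CharacteristicDivides (card L)
  char∣card = trans (sym (*-identityʳ _)) (+-identityˡ-unique _ _ (begin
    fromℕ (card L) * 1# + ∑ id elems ≈⟨ +-congʳ (∑-const 1# elems) ⟨
    ∑ (λ _ → 1#) elems + ∑ id elems  ≈⟨ ∑-∙ (λ _ → 1#) id elems ⟨
    ∑ (1# +_) elems                  ≈⟨ trans (∑-↭ setoid id shift-by-1) (∑-map id (1# +_) elems) ⟨
    ∑ id elems                       ∎))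
    where
    open import Data.List.Relation.Binary.Permutation.Setoid setoid using (_↭_)
    shift-by-1 : elems ↭ map (1# +_) elems
    shift-by-1 = self-injection⇒↭ (+-cancelˡ 1# _ _) distinct (λ {x} _ → complete (1# + x))

  card≡pⁿ⇒char∣p : ∀ {p n} → card L ≡ p ℕ.^ n → CharacteristicDivides p
  card≡pⁿ⇒char∣p {p} {n} |L|≡pⁿ = ^≈0⇒≈0 n (begin
    fromℕ p ^ n         ≈⟨ fromℕ-^ p n ⟨
    fromℕ (p ℕ.^ n)     ≡⟨ ≡.cong fromℕ |L|≡pⁿ ⟨
    fromℕ (card L)      ≈⟨ char∣card ⟩
    0#                  ∎)

  nonzero-resp : ∀ {x y} → x ≈ y → ¬ x ≈ 0# → ¬ y ≈ 0#
  nonzero-resp x≈y x≉0 y≈0 = x≉0 (trans x≈y y≈0)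

  units : List Carrier
  units = filter (λ x → ¬? (x ≈? 0#)) elems

  units! : Unique units
  units! = AllPairs.filter⁺ (λ x → ¬? (x ≈? 0#)) distinct

  units-nonzero : All (λ x → ¬ x ≈ 0#) units
  units-nonzero = All.all-filter (λ x → ¬? (x ≈? 0#)) elems

  ∈-units : ∀ {x} → ¬ x ≈ 0# → x ∈ units
  ∈-units {x} x≉0 = ∈-filter⁺ setoid (λ x → ¬? (x ≈? 0#)) nonzero-resp (complete x) x≉0

  card≡1+|units| : card L ≡ suc (length units)
  card≡1+|units| = ℕ.≤-antisym
    (unique⊆⇒length≤ distinct elems⊆0∷units)
    (unique⊆⇒length≤ (All.map (λ x≉0 0≈x → x≉0 (sym 0≈x)) units-nonzero ∷ units!) 0∷units⊆elems)
    where
    elems⊆0∷units : elems ⊆ 0# ∷ units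
    elems⊆0∷units {x} _ with x ≈? 0#
    ... | yes x≈0 = here x≈0
    ... | no  x≉0 = there (∈-units x≉0)
    0∷units⊆elems : 0# ∷ units ⊆ elems
    0∷units⊆elems {x} _ = complete x

  fermat : ∀ {a} → ¬ a ≈ 0# → a ^ length units ≈ 1#
  fermat {a} a≉0 = sym (*-cancelˡ-nonzero ∏units≉0 (begin
    ∏ id units * 1#                 ≈⟨ *-identityʳ _ ⟩
    ∏ id units                      ≈⟨ ∏-↭ setoid id (self-injection⇒↭ (*-cancelˡ-nonzero a≉0) units! a*-closed) ⟩
    ∏ id (map (a *_) units)         ≈⟨ ∏-map id (a *_) units ⟩
    ∏ (a *_) units                  ≈⟨ ∏-∙ (λ _ → a) id units ⟩
    ∏ (λ _ → a) units * ∏ id units  ≈⟨ *-congʳ (∏-const units) ⟩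
    a ^ length units * ∏ id units   ≈⟨ *-comm _ _ ⟩
    ∏ id units * a ^ length units   ∎))
    where
    open ListSum *-commutativeMonoid using () renaming (∑ to ∏; ∑-↭ to ∏-↭; ∑-map to ∏-map; ∑-∙ to ∏-∙)
    a*-closed : ∀ {x} → x ∈ units → a * x ∈ units
    a*-closed {x} x∈units = ∈-units (nonzero-* a≉0 (All.lookupₛ setoid nonzero-resp units-nonzero x∈units))
    ∏-const : ∀ (xs : List Carrier) → ∏ (λ _ → a) xs ≈ a ^ length xs
    ∏-const []       = refl
    ∏-const (_ ∷ xs) = *-congˡ (∏-const xs)
    ∏-nonzero : ∀ {xs} → All (λ x → ¬ x ≈ 0#) xs → ¬ ∏ id xs ≈ 0#
    ∏-nonzero []          1≈0 = 0≉1 (sym 1≈0)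
    ∏-nonzero (x≉0 ∷ xs≉0)    = nonzero-* x≉0 (∏-nonzero xs≉0)
    ∏units≉0 : ¬ ∏ id units ≈ 0#
    ∏units≉0 = ∏-nonzero units-nonzero

  nontrivial-root-of-unity : ∀ {q} → 2 ≤ q → q ∣ card L ∸ 1 → ∃ λ x → x ^ q ≈ 1# × ¬ x ≈ 1#
  nontrivial-root-of-unity {q} 2≤q (divides m |L|-1≡m*q) = search (All.all? (λ y → (y ^ m) ≈? 1#) units)
    where
    |units|≡m*q : length units ≡ m ℕ.* q
    |units|≡m*q = ≡.trans (≡.cong (ℕ._∸ 1) (≡.sym card≡1+|units|)) |L|-1≡m*q

    search : Dec (All (λ y → y ^ m ≈ 1#) units) → ∃ λ x → x ^ q ≈ 1# × ¬ x ≈ 1#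
    search (no ¬all) = y ^ m , y^m^q≈1 , y^m≉1
      where
      witness : Any (λ y → ¬ y ^ m ≈ 1#) units
      witness = All.¬All⇒Any¬ (λ y → (y ^ m) ≈? 1#) units ¬all
      y : Carrier
      y = Any.lookup witness
      y≉0 : ¬ y ≈ 0#
      y≉0 = proj₁ (All.lookupAny units-nonzero witness)
      y^m≉1 : ¬ y ^ m ≈ 1#
      y^m≉1 = proj₂ (All.lookupAny units-nonzero witness)
      y^m^q≈1 : (y ^ m) ^ q ≈ 1#
      y^m^q≈1 = begin
        (y ^ m) ^ q       ≈⟨ ^-assocʳ y m q ⟩
        y ^ (m ℕ.* q)     ≡⟨ ≡.cong (y ^_) |units|≡m*q ⟨
        y ^ length units  ≈⟨ fermat y≉0 ⟩
        1#                ∎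
    search (yes all) = ⊥-elim (ℕ.<⇒≱ m<|units| (xⁿ≈xᵐ-solutions≤n 0<m units! all))
      where
      0<|units| : 0 < length units
      0<|units| with units | ∈-units {1#} (0≉1 ∘ sym)
      ... | []    | ()
      ... | _ ∷ _ | _  = s≤s z≤n
      0<m : 0 < m
      0<m = ℕ.n≢0⇒n>0 (λ m≡0 → ℕ.<⇒≢ 0<|units| (≡.sym (≡.trans |units|≡m*q (≡.cong (ℕ._* q) m≡0))))
      m<|units| : m < length units
      m<|units| = ℕ.<-≤-trans (ℕ.m<m*n m q {{ℕ.>-nonZero 0<m}} 2≤q) (ℕ.≤-reflexive (≡.sym |units|≡m*q))

module PrimeBinomial where

  open import Data.Nat using (ℕ; zero; suc; _*_; _∸_; _<_; _!; NonZero; nonTrivial⇒n>1)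
  import Data.Nat.Properties as ℕ
  open import Data.Nat.Divisibility using (_∣_; ∣⇒≤; ∣1⇒≡1; m∣m*n)
  open import Data.Nat.DivMod using (m/n*n≡m)
  open import Data.Nat.Primality using (Prime; euclidsLemma; prime⇒nonZero; prime⇒nonTrivial)
  open import Data.Nat.Combinatorics using (_C_; nCk≡n!/k![n-k]!; k![n∸k]!∣n!)
  open import Data.Sum using (inj₁; inj₂; [_,_]′)
  open import Function using (id)
  open import Data.Empty using (⊥-elim)
  open import Relation.Nullary using (¬_)
  open import Relation.Binary.PropositionalEquality as ≡ using (_≡_)

  prime⇒1<p : ∀ {p} → Prime p → 1 < p
  prime⇒1<p {p} pr = nonTrivial⇒n>1 p {{prime⇒nonTrivial pr}}

  prime∤! : ∀ {p m} → Prime p → m < p → ¬ p ∣ m !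
  prime∤! {p} {zero}  pr _   p∣1 = ℕ.<-irrefl (≡.sym (∣1⇒≡1 p∣1)) (prime⇒1<p pr)
  prime∤! {p} {suc m} pr m<p p∣m! with euclidsLemma (suc m) (m !) pr p∣m!
  ... | inj₁ p∣m+1 = ℕ.<-irrefl ≡.refl (ℕ.<-≤-trans m<p (∣⇒≤ p∣m+1))
  ... | inj₂ p∣m!  = prime∤! pr (ℕ.<-trans (ℕ.n<1+n m) m<p) p∣m!

  prime∣choose : ∀ {p k} → Prime p → 0 < k → k < p → p ∣ p C k
  prime∣choose {p} {k} pr 0<k k<p = [ id , (λ p∣k![p-k]! → ⊥-elim (p∤k![p-k]! p∣k![p-k]!)) ]′
    (euclidsLemma (p C k) (k ! * (p ∸ k) !) pr (≡.subst (p ∣_) (≡.sym C*k![p-k]!≡p!) (n∣n! p {{prime⇒nonZero pr}})))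
    where
    instance
      _ : NonZero (k ! * (p ∸ k) !)
      _ = k ℕ.!* (p ∸ k) !≢0
    C*k![p-k]!≡p! : (p C k) * (k ! * (p ∸ k) !) ≡ p !
    C*k![p-k]!≡p! = ≡.trans (≡.cong (_* (k ! * (p ∸ k) !)) (nCk≡n!/k![n-k]! (ℕ.<⇒≤ k<p)))
                            (m/n*n≡m (k![n∸k]!∣n! (ℕ.<⇒≤ k<p)))
    n∣n! : ∀ n → .{{NonZero n}} → n ∣ n !
    n∣n! (suc n) = m∣m*n (n !)
    p∤k![p-k]! : ¬ p ∣ k ! * (p ∸ k) !
    p∤k![p-k]! p∣k![p-k]! = [ prime∤! pr k<p , prime∤! pr (ℕ.∸-monoʳ-< 0<k (ℕ.<⇒≤ k<p)) ]′
      (euclidsLemma (k !) ((p ∸ k) !) pr p∣k![p-k]!)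

module PrimeCharacteristic (L : FiniteField) (p : ℕ) (p-prime : Prime p)
  (char∣p : FiniteFieldProperties.CharacteristicDivides L p) where

  open FiniteField L
  open CommutativeRing ring hiding (ring)
  open IntegerCoefficientSolver ring using (fromℕ)

  open import Data.Nat as ℕ using (zero; suc; _<_; _≤_; z≤n; s≤s; _%_; _/_; NonZero)
  import Data.Nat.Properties as ℕ
  open import Data.Nat.DivMod using (m≡m%n+[m/n]*n; m%n<n)
  open import Data.Nat.Divisibility as ∣ using (_∣_; divides)
  open import Data.Nat.Coprimality using (prime⇒coprime; coprime-Bézout)
  open import Data.Nat.GCD using (module Bézout)
  open import Data.Nat.Primality using (prime⇒nonZero)
  open import Data.List using (List; []; _∷_; upTo; applyUpTo)
  open import Data.List.Properties using (length-applyUpTo)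
  open import Data.List.Relation.Unary.All using (All; _∷_)
  import Data.List.Relation.Unary.All.Properties as All
  open import Data.List.Relation.Unary.Any using (any?)
  import Data.List.Relation.Unary.Any.Properties as Any
  import Data.List.Relation.Unary.AllPairs.Properties as AllPairs
  open import Data.List.Relation.Unary.AllPairs using (_∷_)
  open import Data.Product using (∃; _×_)
  open import Data.Empty using (⊥-elim)
  open import Function using (id; _∘_)
  open import Relation.Nullary using (¬_; yes; no)
  open import Relation.Binary.Definitions using (tri<; tri≈; tri>)
  open import Relation.Binary.PropositionalEquality as ≡ using (_≡_)

  open IntegerCoefficientSolver ring using (fromℕ-suc; fromℕ-+; fromℕ-*)
  open PrimeBinomial using (prime∣choose; prime⇒1<p)
  open import Data.List.Relation.Unary.Unique.Setoid setoid using (Unique)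
  open import Relation.Binary.Reasoning.Setoid setoid
  open import Algebra.Properties.Ring (CommutativeRing.ring ring) using (+-cancelˡ)

  instance
    p≢0 : NonZero p
    p≢0 = prime⇒nonZero p-prime

  ∣⇒fromℕ≈0 : ∀ {m} → p ∣ m → fromℕ m ≈ 0#
  ∣⇒fromℕ≈0 (divides d ≡.refl) = trans (fromℕ-* d p) (trans (*-congˡ char∣p) (zeroʳ _))

  fromℕ-mod : ∀ m → fromℕ m ≈ fromℕ (m % p)
  fromℕ-mod m = begin
    fromℕ m                                ≡⟨ ≡.cong fromℕ (m≡m%n+[m/n]*n m p) ⟩
    fromℕ (m % p ℕ.+ m / p ℕ.* p)          ≈⟨ fromℕ-+ (m % p) _ ⟩
    fromℕ (m % p) + fromℕ (m / p ℕ.* p)    ≈⟨ +-congˡ (∣⇒fromℕ≈0 (∣.n∣m*n (m / p))) ⟩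
    fromℕ (m % p) + 0#                     ≈⟨ +-identityʳ _ ⟩
    fromℕ (m % p)                          ∎

  1+m*a≢n*b : ∀ {a b} m n → fromℕ a ≈ 0# → fromℕ b ≈ 0# → ¬ 1 ℕ.+ m ℕ.* a ≡ n ℕ.* b
  1+m*a≢n*b {a} {b} m n a≈0 b≈0 eq = 0≉1 (begin
    0#                       ≈⟨ zeroʳ (fromℕ n) ⟨
    fromℕ n * 0#             ≈⟨ *-congˡ b≈0 ⟨
    fromℕ n * fromℕ b        ≈⟨ fromℕ-* n b ⟨
    fromℕ (n ℕ.* b)          ≡⟨ ≡.cong fromℕ eq ⟨
    fromℕ (suc (m ℕ.* a))    ≈⟨ fromℕ-suc (m ℕ.* a) ⟩
    1# + fromℕ (m ℕ.* a)     ≈⟨ +-congˡ (trans (fromℕ-* m a) (trans (*-congˡ a≈0) (zeroʳ _))) ⟩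
    1# + 0#                  ≈⟨ +-identityʳ 1# ⟩
    1#                       ∎)

  fromℕ-nonzero : ∀ {k} → 0 < k → k < p → ¬ fromℕ k ≈ 0#
  fromℕ-nonzero {k} 0<k k<p k≈0 with coprime-Bézout (prime⇒coprime p-prime {{ℕ.>-nonZero 0<k}} k<p)
  ... | Bézout.+- x y 1+yk≡xp = 1+m*a≢n*b y x k≈0 char∣p 1+yk≡xp
  ... | Bézout.-+ x y 1+xp≡yk = 1+m*a≢n*b x y char∣p k≈0 1+xp≡yk

  fromℕ≈0⇒∣ : ∀ {m} → fromℕ m ≈ 0# → p ∣ m
  fromℕ≈0⇒∣ {m} m≈0 with m % p in m%p≡r | m%n<n m p
  ... | zero  | _     = ∣.m%n≡0⇒n∣m m p m%p≡r
  ... | suc r | r+1<p = ⊥-elim (fromℕ-nonzero (s≤s z≤n) r+1<p (begin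
    fromℕ (suc r)  ≡⟨ ≡.cong fromℕ m%p≡r ⟨
    fromℕ (m % p)  ≈⟨ fromℕ-mod m ⟨
    fromℕ m        ≈⟨ m≈0 ⟩
    0#             ∎))

  fromℕ-distinct : ∀ {i j} → i < j → j < p → ¬ fromℕ i ≈ fromℕ j
  fromℕ-distinct {i} {j} i<j j<p i≈j = fromℕ-nonzero (ℕ.m<n⇒0<n∸m i<j) (ℕ.≤-<-trans (ℕ.m∸n≤m j i) j<p)
    (+-cancelˡ (fromℕ i) _ _ (begin
      fromℕ i + fromℕ (j ℕ.∸ i)  ≈⟨ fromℕ-+ i (j ℕ.∸ i) ⟨
      fromℕ (i ℕ.+ (j ℕ.∸ i))    ≡⟨ ≡.cong fromℕ (ℕ.m+[n∸m]≡n (ℕ.<⇒≤ i<j)) ⟩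
      fromℕ j                    ≈⟨ i≈j ⟨
      fromℕ i                    ≈⟨ +-identityʳ _ ⟨
      fromℕ i + 0#               ∎))

  fromℕ-injective : ∀ {i j} → i < p → j < p → fromℕ i ≈ fromℕ j → i ≡ j
  fromℕ-injective {i} {j} i<p j<p i≈j with ℕ.<-cmp i j
  ... | tri< i<j _ _ = ⊥-elim (fromℕ-distinct i<j j<p i≈j)
  ... | tri≈ _ i≡j _ = i≡j
  ... | tri> _ _ j<i = ⊥-elim (fromℕ-distinct j<i i<p (sym i≈j))

  module _ where
    open import Data.Fin as Fin using (Fin; toℕ; inject₁)
    import Data.Fin.Properties as Fin
    open import Data.Nat.Combinatorics using (_C_; nCn≡1)
    open import Algebra.Properties.Semiring.Mult semiring using (×-assoc-*; ×-congʳ) renaming (_×_ to _×ᵤ_)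
    open import Algebra.Properties.Semiring.Mult.TCOptimised semiring using (×ᵤ≈×)
    open import Algebra.Properties.Semiring.Sum semiring using (sum; sum-init-last; sum-cong-≋; sum-replicate-zero)
    open import Algebra.Properties.CommutativeSemiring.Binomial commutativeSemiring using (theorem; binomialExpansion)
    open import Algebra.Properties.Semiring.Exp semiring using (_^_)

    fromℕ≈0⇒×ᵤ≈0 : ∀ n → fromℕ n ≈ 0# → ∀ z → n ×ᵤ z ≈ 0#
    fromℕ≈0⇒×ᵤ≈0 n n≈0 z = begin
      n ×ᵤ z           ≈⟨ ×-congʳ n (*-identityˡ z) ⟨
      n ×ᵤ (1# * z)    ≈⟨ ×-assoc-* n 1# z ⟨
      (n ×ᵤ 1#) * z    ≈⟨ *-congʳ (trans (×ᵤ≈× n 1#) n≈0) ⟩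
      0# * z           ≈⟨ zeroˡ z ⟩
      0#               ∎

    binomial-ends : ∀ m → 0 < m → (∀ j → 0 < j → j < m → fromℕ (m C j) ≈ 0#) →
                    ∀ x y → (x + y) ^ m ≈ x ^ m + y ^ m
    binomial-ends (suc n) _ inner≈0 x y = begin
      (x + y) ^ suc n                          ≈⟨ theorem (suc n) x y ⟩
      binomialExpansion x y (suc n)            ≈⟨ +-congˡ (sum-init-last {n} (λ k → term (suc (toℕ k)))) ⟩
      term 0 + (sum {n} (λ k → term (suc (toℕ (inject₁ k)))) + term (suc (toℕ (Fin.fromℕ n))))
        ≈⟨ +-congˡ (+-cong (trans (sum-cong-≋ {n} inner) (sum-replicate-zero n))
                           (reflexive (≡.cong (term ∘ suc) (Fin.toℕ-fromℕ n)))) ⟩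
      term 0 + (0# + term (suc n))             ≈⟨ +-cong (trans (+-identityʳ _) (*-identityˡ _)) (trans (+-identityˡ _) last-term) ⟩
      y ^ suc n + x ^ suc n                    ≈⟨ +-comm _ _ ⟩
      x ^ suc n + y ^ suc n                    ∎
      where
      term : ℕ → Carrier
      term j = (suc n C j) ×ᵤ (x ^ j * y ^ (suc n ℕ.∸ j))
      last-term : term (suc n) ≈ x ^ suc n
      last-term = begin
        (suc n C suc n) ×ᵤ (x ^ suc n * y ^ (n ℕ.∸ n))
          ≡⟨ ≡.cong₂ (λ c e → c ×ᵤ (x ^ suc n * y ^ e)) (nCn≡1 (suc n)) (ℕ.n∸n≡0 n) ⟩
        1 ×ᵤ (x ^ suc n * 1#)                           ≈⟨ +-identityʳ _ ⟩
        x ^ suc n * 1#                                  ≈⟨ *-identityʳ _ ⟩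
        x ^ suc n                                       ∎
      inner-term : ∀ j → 0 < j → j < suc n → term j ≈ 0#
      inner-term j 0<j j<m = fromℕ≈0⇒×ᵤ≈0 (suc n C j) (inner≈0 j 0<j j<m) (x ^ j * y ^ (suc n ℕ.∸ j))
      inner : ∀ k → term (suc (toℕ (inject₁ k))) ≈ 0#
      inner k = inner-term (suc (toℕ (inject₁ k))) (s≤s z≤n) (s≤s (Fin.inject₁ℕ< k))

    frobenius-+ : ∀ x y → (x + y) ^ p ≈ x ^ p + y ^ p
    frobenius-+ = binomial-ends p (ℕ.>-nonZero⁻¹ p) (λ j 0<j j<p → ∣⇒fromℕ≈0 (prime∣choose p-prime 0<j j<p))

  open import Algebra.Properties.Semiring.Exp semiring using (_^_; ^-congˡ)
  open FiniteFieldProperties L using (xⁿ≈xᵐ-solutions≤n; 1^n≈1)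
  open RingListSum ring using (∑)

  0^p≈0 : 0# ^ p ≈ 0#
  0^p≈0 = 0^[1+n] p
    where
    0^[1+n] : ∀ n → .{{NonZero n}} → 0# ^ n ≈ 0#
    0^[1+n] (suc n) = zeroˡ _

  frobenius-fromℕ : ∀ k → fromℕ k ^ p ≈ fromℕ k
  frobenius-fromℕ zero    = 0^p≈0
  frobenius-fromℕ (suc k) = begin
    fromℕ (suc k) ^ p         ≈⟨ ^-congˡ p (fromℕ-suc k) ⟩
    (1# + fromℕ k) ^ p        ≈⟨ frobenius-+ 1# (fromℕ k) ⟩
    1# ^ p + fromℕ k ^ p      ≈⟨ +-cong (1^n≈1 p) (frobenius-fromℕ k) ⟩
    1# + fromℕ k              ≈⟨ fromℕ-suc k ⟨
    fromℕ (suc k)             ∎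

  ∑-frobenius : ∀ {a} {A : Set a} (f : A → Carrier) xs → ∑ f xs ^ p ≈ ∑ (λ x → f x ^ p) xs
  ∑-frobenius f []       = 0^p≈0
  ∑-frobenius f (x ∷ xs) = trans (frobenius-+ _ _) (+-congˡ (∑-frobenius f xs))

  frobenius-fixed⇒fromℕ : ∀ {y} → y ^ p ≈ y → ∃ λ k → k < p × y ≈ fromℕ k
  frobenius-fixed⇒fromℕ {y} y^p≈y with any? (λ k → y ≈? fromℕ k) (upTo p)
  ... | yes y∈Fp = Any.applyUpTo⁻ id y∈Fp
  ... | no  y∉Fp = ⊥-elim (ℕ.<-irrefl ≡.refl (≡.subst (_≤ p) (≡.cong suc (length-applyUpTo fromℕ p))
                     (xⁿ≈xᵐ-solutions≤n (prime⇒1<p p-prime) y∷Fp! roots)))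
    where
    Fp : List Carrier
    Fp = applyUpTo fromℕ p
    y∷Fp! : Unique (y ∷ Fp)
    y∷Fp! = All.applyUpTo⁺₁ fromℕ p (λ i<p y≈i → y∉Fp (Any.applyUpTo⁺ id y≈i i<p))
          ∷ AllPairs.applyUpTo⁺₁ fromℕ p fromℕ-distinct
    fixed : ∀ {z} → z ^ p ≈ z → z ^ p ≈ z ^ 1
    fixed z^p≈z = trans z^p≈z (sym (*-identityʳ _))
    roots : All (λ r → r ^ p ≈ r ^ 1) (y ∷ Fp)
    roots = fixed y^p≈y ∷ All.applyUpTo⁺₂ fromℕ p (λ i → fixed (frobenius-fromℕ i))

module Congruence (q : ℕ) .{{_ : NonZero q}} where

  open import Data.Nat as ℕ using (zero; suc; _+_; _*_; _^_; _∸_; _%_; _/_; _≤_; _<_)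
  import Data.Nat.Properties as ℕ
  open import Data.Nat.DivMod
  open import Data.Nat.Divisibility as ∣ using (_∣_; divides)
  open import Data.Nat.Primality using (Prime; euclidsLemma)
  open import Data.Sum using (inj₁; inj₂)
  open import Data.Empty using (⊥-elim)
  open import Relation.Nullary using (¬_; Dec)
  open import Relation.Binary.PropositionalEquality as ≡ using (_≡_; refl; sym; trans; cong; cong₂)
  open ≡.≡-Reasoning

  infix 4 _~_
  _~_ : ℕ → ℕ → Set
  a ~ b = a % q ≡ b % q

  ~-setoid : Setoid _ _
  ~-setoid = record { Carrier = ℕ ; _≈_ = _~_ ; isEquivalence = record { refl = refl ; sym = sym ; trans = trans } }

  _~?_ : ∀ a b → Dec (a ~ b)
  a ~? b = a % q ℕ.≟ b % q

  ~-+ : ∀ {a a′ b b′} → a ~ a′ → b ~ b′ → a + b ~ a′ + b′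
  ~-+ {a} {a′} {b} {b′} a~a′ b~b′ = begin
    (a + b) % q               ≡⟨ %-distribˡ-+ a b q ⟩
    (a % q + b % q) % q       ≡⟨ cong₂ (λ x y → (x + y) % q) a~a′ b~b′ ⟩
    (a′ % q + b′ % q) % q     ≡⟨ %-distribˡ-+ a′ b′ q ⟨
    (a′ + b′) % q             ∎

  ~-* : ∀ {a a′ b b′} → a ~ a′ → b ~ b′ → a * b ~ a′ * b′
  ~-* {a} {a′} {b} {b′} a~a′ b~b′ = begin
    (a * b) % q               ≡⟨ %-distribˡ-* a b q ⟩
    (a % q * (b % q)) % q     ≡⟨ cong₂ (λ x y → (x * y) % q) a~a′ b~b′ ⟩
    (a′ % q * (b′ % q)) % q   ≡⟨ %-distribˡ-* a′ b′ q ⟨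
    (a′ * b′) % q             ∎

  ~-^ : ∀ {a b} n → a ~ b → a ^ n ~ b ^ n
  ~-^ zero    a~b = refl
  ~-^ (suc n) a~b = ~-* a~b (~-^ n a~b)

  <-~⇒≡ : ∀ {a b} → a < q → b < q → a ~ b → a ≡ b
  <-~⇒≡ a<q b<q a~b = trans (sym (m<n⇒m%n≡m a<q)) (trans a~b (m<n⇒m%n≡m b<q))

  0%q≡0 : 0 % q ≡ 0
  0%q≡0 = m<n⇒m%n≡m (ℕ.>-nonZero⁻¹ q)

  ∣⇒~0 : ∀ {a} → q ∣ a → a ~ 0
  ∣⇒~0 {a} q∣a = trans (∣.n∣m⇒m%n≡0 a q q∣a) (sym 0%q≡0)

  ~0⇒∣ : ∀ {a} → a ~ 0 → q ∣ a
  ~0⇒∣ {a} a~0 = ∣.m%n≡0⇒n∣m a q (trans a~0 0%q≡0)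

  ∣∸⇒~ : ∀ {a b} → b ≤ a → q ∣ a ∸ b → a ~ b
  ∣∸⇒~ {a} {b} b≤a q∣a-b = trans (cong (_% q) (sym (ℕ.m∸n+n≡m b≤a))) (%-remove-+ˡ b q∣a-b)

  ~⇒∣∸ : ∀ {a b} → a ~ b → q ∣ a ∸ b
  ~⇒∣∸ {a} {b} a~b = divides (a / q ∸ b / q) (begin
    a ∸ b                                     ≡⟨ cong₂ _∸_ (m≡m%n+[m/n]*n a q) (m≡m%n+[m/n]*n b q) ⟩
    (a % q + a / q * q) ∸ (b % q + b / q * q) ≡⟨ cong (λ r → (r + a / q * q) ∸ (b % q + b / q * q)) a~b ⟩
    (b % q + a / q * q) ∸ (b % q + b / q * q) ≡⟨ ℕ.[m+n]∸[m+o]≡n∸o (b % q) _ _ ⟩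
    a / q * q ∸ b / q * q                     ≡⟨ ℕ.*-distribʳ-∸ q (a / q) (b / q) ⟨
    (a / q ∸ b / q) * q                       ∎)

  module PrimeModulus (q-prime : Prime q) where

    nonzero-~* : ∀ {a b} → ¬ a ~ 0 → ¬ b ~ 0 → ¬ a * b ~ 0
    nonzero-~* a≁0 b≁0 ab~0 with euclidsLemma _ _ q-prime (~0⇒∣ ab~0)
    ... | inj₁ q∣a = a≁0 (∣⇒~0 q∣a)
    ... | inj₂ q∣b = b≁0 (∣⇒~0 q∣b)

    private
      *-cancelˡ-~-≤ : ∀ {a b c} → ¬ a ~ 0 → c ≤ b → a * b ~ a * c → b ~ c
      *-cancelˡ-~-≤ {a} {b} {c} a≁0 c≤b ab~ac
        with euclidsLemma a (b ∸ c) q-prime (≡.subst (q ∣_) (sym (ℕ.*-distribˡ-∸ a b c)) (~⇒∣∸ ab~ac))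
      ... | inj₁ q∣a   = ⊥-elim (a≁0 (∣⇒~0 q∣a))
      ... | inj₂ q∣b-c = ∣∸⇒~ c≤b q∣b-c

    *-cancelˡ-~ : ∀ {a b c} → ¬ a ~ 0 → a * b ~ a * c → b ~ c
    *-cancelˡ-~ {a} {b} {c} a≁0 ab~ac with ℕ.≤-total c b
    ... | inj₁ c≤b = *-cancelˡ-~-≤ a≁0 c≤b ab~ac
    ... | inj₂ b≤c = sym (*-cancelˡ-~-≤ a≁0 b≤c (sym ab~ac))

    *-cancelʳ-~ : ∀ {a b c} → ¬ a ~ 0 → b * a ~ c * a → b ~ c
    *-cancelʳ-~ {a} {b} {c} a≁0 ba~ca =
      *-cancelˡ-~ a≁0 (trans (cong (_% q) (ℕ.*-comm a b)) (trans ba~ca (cong (_% q) (ℕ.*-comm c a))))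

module _ where
  open import Data.Nat using (_^_; _∸_; _<_)
  open import Data.Nat.Divisibility using (_∣_)
  open import Relation.Nullary using (¬_)

  record MultiplicativeOrder (p q ℓ : ℕ) : Set where
    field
      q∣pˡ-1  : q ∣ p ^ ℓ ∸ 1
      minimal : ∀ k → 0 < k → k < ℓ → ¬ q ∣ p ^ k ∸ 1

module Residues (p q ℓ : ℕ) .{{_ : NonZero p}} (q-prime : Prime q) (q≡2ℓ+1 : 2 ℕ.* ℓ ℕ.+ 1 ≡ q)
  (p-order : MultiplicativeOrder p q ℓ) where

  open import Data.Nat as ℕ using (zero; suc; _+_; _*_; _^_; _∸_; _%_; _/_; _≤_; _<_; z≤n; s≤s)
  import Data.Nat.Properties as ℕ
  open import Data.Nat.DivMod using (m≡m%n+[m/n]*n; m%n<n; m<n⇒m%n≡m)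
  open import Data.Nat.Divisibility as ∣ using (_∣_; divides)
  open import Data.Nat.Primality using (prime⇒nonZero; euclidsLemma)
  open import Data.Nat.Tactic.RingSolver using (solve-∀)
  open import Data.List using (List; []; _∷_; _++_; length; applyUpTo; map)
  import Data.List.Properties as List
  open import Data.List.Relation.Unary.Any as Any using (Any; any?)
  import Data.List.Relation.Unary.Any.Properties as Any
  open import Data.List.Relation.Unary.All as All using (All; []; _∷_)
  import Data.List.Relation.Unary.All.Properties as All
  import Data.List.Relation.Unary.AllPairs.Properties as AllPairs
  open import Data.Product using (∃; _×_; _,_)
  open import Data.Sum using (_⊎_; inj₁; inj₂)
  open import Data.Empty using (⊥-elim)
  open import Function using (_∘_)
  open import Relation.Nullary using (¬_; Dec; yes; no)
  open import Relation.Binary.PropositionalEquality as ≡ using (refl; sym; trans; cong)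
  open PrimeBinomial using (prime⇒1<p)
  open import Data.Nat.Coprimality as Coprime using (Coprime)

  instance
    q≢0 : NonZero q
    q≢0 = prime⇒nonZero q-prime

  open Congruence q
  open PrimeModulus q-prime
  open MultiplicativeOrder p-order
  open ≡.≡-Reasoning

  q≡1+ℓ+ℓ : q ≡ suc (ℓ + ℓ)
  q≡1+ℓ+ℓ = trans (sym q≡2ℓ+1) (2n+1≡1+n+n ℓ)
    where
    2n+1≡1+n+n : ∀ n → 2 * n + 1 ≡ suc (n + n)
    2n+1≡1+n+n = solve-∀

  0<ℓ : 0 < ℓ
  0<ℓ = positive ℓ q≡1+ℓ+ℓ
    where
    positive : ∀ n → q ≡ suc (n + n) → 0 < n
    positive zero    q≡1 = ⊥-elim (ℕ.<-irrefl (sym q≡1) (prime⇒1<p q-prime))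
    positive (suc _) _   = s≤s z≤n

  instance
    ℓ≢0 : NonZero ℓ
    ℓ≢0 = ℕ.>-nonZero 0<ℓ

  1<q : 1 < q
  1<q = prime⇒1<p q-prime

  1≁0 : ¬ 1 ~ 0
  1≁0 1~0 with trans (sym (m<n⇒m%n≡m 1<q)) (trans 1~0 0%q≡0)
  ... | ()

  1≤pⁿ : ∀ n → 1 ≤ p ^ n
  1≤pⁿ n = ℕ.m^n>0 p n

  pˡ~1 : p ^ ℓ ~ 1
  pˡ~1 = ∣∸⇒~ (1≤pⁿ ℓ) q∣pˡ-1

  p≁0 : ¬ p ~ 0
  p≁0 p~0 = 1≁0 (begin
    1 % q                ≡⟨ pˡ~1 ⟨
    p ^ ℓ % q            ≡⟨ ~-^ ℓ p~0 ⟩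
    0 ^ ℓ % q            ≡⟨ cong (_% q) (0^n≡0 ℓ) ⟩
    0 % q                ∎)
    where
    0^n≡0 : ∀ n → .{{NonZero n}} → 0 ^ n ≡ 0
    0^n≡0 (suc n) = refl

  pⁿ≁0 : ∀ n → ¬ p ^ n ~ 0
  pⁿ≁0 zero    = 1≁0
  pⁿ≁0 (suc n) = nonzero-~* p≁0 (pⁿ≁0 n)

  pˡᵏ~1 : ∀ k → p ^ (ℓ * k) ~ 1
  pˡᵏ~1 k = begin
    p ^ (ℓ * k) % q   ≡⟨ cong (_% q) (ℕ.^-*-assoc p ℓ k) ⟨
    (p ^ ℓ) ^ k % q   ≡⟨ ~-^ k pˡ~1 ⟩
    1 ^ k % q         ≡⟨ cong (_% q) (ℕ.^-zeroˡ k) ⟩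
    1 % q             ∎

  pⁿ~pⁿ%ˡ : ∀ n → p ^ n ~ p ^ (n % ℓ)
  pⁿ~pⁿ%ˡ n = begin
    p ^ n % q                              ≡⟨ cong (λ e → p ^ e % q) (m≡m%n+[m/n]*n n ℓ) ⟩
    p ^ (n % ℓ + n / ℓ * ℓ) % q            ≡⟨ cong (_% q) (ℕ.^-distribˡ-+-* p (n % ℓ) _) ⟩
    (p ^ (n % ℓ) * p ^ (n / ℓ * ℓ)) % q
      ≡⟨ ~-* {p ^ (n % ℓ)} refl (≡.subst (λ e → p ^ e ~ 1) (ℕ.*-comm ℓ (n / ℓ)) (pˡᵏ~1 (n / ℓ))) ⟩
    (p ^ (n % ℓ) * 1) % q                  ≡⟨ cong (_% q) (ℕ.*-identityʳ _) ⟩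
    p ^ (n % ℓ) % q                        ∎

  pⁱ≁pʲ : ∀ {i j} → i < j → j < ℓ → ¬ p ^ i ~ p ^ j
  pⁱ≁pʲ {i} {j} i<j j<ℓ pⁱ~pʲ = minimal (j ∸ i) (ℕ.m<n⇒0<n∸m i<j) (ℕ.≤-<-trans (ℕ.m∸n≤m j i) j<ℓ)
    (~⇒∣∸ (sym (*-cancelˡ-~ (pⁿ≁0 i) (begin
      (p ^ i * 1) % q           ≡⟨ cong (_% q) (ℕ.*-identityʳ _) ⟩
      p ^ i % q                 ≡⟨ pⁱ~pʲ ⟩
      p ^ j % q                 ≡⟨ cong (λ e → p ^ e % q) (ℕ.m+[n∸m]≡n (ℕ.<⇒≤ i<j)) ⟨
      p ^ (i + (j ∸ i)) % q     ≡⟨ cong (_% q) (ℕ.^-distribˡ-+-* p i _) ⟩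
      (p ^ i * p ^ (j ∸ i)) % q ∎))))

  pⁿ~1⇒n%ℓ≡0 : ∀ {n} → p ^ n ~ 1 → n % ℓ ≡ 0
  pⁿ~1⇒n%ℓ≡0 {n} pⁿ~1 with n % ℓ in n%ℓ≡r | m%n<n n ℓ
  ... | zero  | _     = refl
  ... | suc r | r+1<ℓ = ⊥-elim (minimal (suc r) (s≤s z≤n) r+1<ℓ
        (~⇒∣∸ (trans (sym (≡.subst (λ e → p ^ n ~ p ^ e) n%ℓ≡r (pⁿ~pⁿ%ˡ n))) pⁿ~1)))

  open UniqueSublist ~-setoid
  open import Data.List.Membership.Setoid ~-setoid using (_∈_)
  open import Data.List.Relation.Unary.Unique.Setoid ~-setoid using (Unique)
  open import Data.List.Relation.Binary.Subset.Setoid ~-setoid using (_⊆_)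
  open import Data.List.Relation.Binary.Permutation.Setoid ~-setoid using (_↭_)
  open import Data.List.Relation.Binary.Permutation.Setoid.Properties ~-setoid using (∈-resp-↭)
  open import Data.List.Membership.Setoid.Properties using (∈-map⁻)

  1+i<q : ∀ {i} → i < ℓ + ℓ → suc i < q
  1+i<q i<2ℓ = ≡.subst (_ <_) (sym q≡1+ℓ+ℓ) (s≤s i<2ℓ)

  residues : List ℕ
  residues = applyUpTo suc (ℓ + ℓ)

  residues! : Unique residues
  residues! = AllPairs.applyUpTo⁺₁ suc (ℓ + ℓ)
    (λ i<j j<2ℓ i+1~j+1 → ℕ.<⇒≢ i<j (ℕ.suc-injective (<-~⇒≡ (1+i<q (ℕ.<-trans i<j j<2ℓ)) (1+i<q j<2ℓ) i+1~j+1)))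

  length-residues : length residues ≡ ℓ + ℓ
  length-residues = List.length-applyUpTo suc (ℓ + ℓ)

  residues-nonzero : All (λ a → ¬ a ~ 0) residues
  residues-nonzero = All.applyUpTo⁺₁ suc (ℓ + ℓ)
    (λ i<2ℓ i+1~0 → ℕ.1+n≢0 (<-~⇒≡ (1+i<q i<2ℓ) (ℕ.<-trans (s≤s z≤n) 1<q) i+1~0))

  ∈-residues : ∀ {a} → ¬ a ~ 0 → a ∈ residues
  ∈-residues {a} a≁0 with a % q | m%n<n a q
  ... | zero  | _     = ⊥-elim (a≁0 (sym 0%q≡0))
  ... | suc r | r+1<q = Any.applyUpTo⁺ suc (sym (m<n⇒m%n≡m r+1<q))
                          (ℕ.≤-pred (≡.subst (suc r <_) q≡1+ℓ+ℓ r+1<q))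

  pᵐ⁺ˡⁿ~pᵐ : ∀ m n → p ^ (m + ℓ * n) ~ p ^ m
  pᵐ⁺ˡⁿ~pᵐ m n = begin
    p ^ (m + ℓ * n) % q           ≡⟨ cong (_% q) (ℕ.^-distribˡ-+-* p m (ℓ * n)) ⟩
    (p ^ m * p ^ (ℓ * n)) % q     ≡⟨ ~-* {p ^ m} refl (pˡᵏ~1 n) ⟩
    (p ^ m * 1) % q               ≡⟨ cong (_% q) (ℕ.*-identityʳ _) ⟩
    p ^ m % q                     ∎

  nonzero-resp : ∀ {a b} → a ~ b → ¬ a ~ 0 → ¬ b ~ 0
  nonzero-resp a~b a≁0 b~0 = a≁0 (trans a~b b~0)

  residues↭a*residues : ∀ {a} → ¬ a ~ 0 → residues ↭ map (a *_) residues
  residues↭a*residues a≁0 = self-injection⇒↭ (*-cancelˡ-~ a≁0) residues!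
    (λ b∈residues → ∈-residues (nonzero-~* a≁0 (All.lookupₛ ~-setoid nonzero-resp residues-nonzero b∈residues)))

  ~-inverse : ∀ {a} → ¬ a ~ 0 → ∃ λ b → a * b ~ 1
  ~-inverse a≁0 with b , _ , 1~ab ← ∈-map⁻ ~-setoid ~-setoid (∈-resp-↭ (residues↭a*residues a≁0) (∈-residues 1≁0)) =
    b , sym 1~ab

  IsPower : ℕ → Set
  IsPower a = ∃ λ n → a ~ p ^ n

  powers : List ℕ
  powers = applyUpTo (p ^_) ℓ

  powers! : Unique powers
  powers! = AllPairs.applyUpTo⁺₁ (p ^_) ℓ pⁱ≁pʲ

  IsPower⇒∈ : ∀ {a} → IsPower a → a ∈ powers
  IsPower⇒∈ (n , a~pⁿ) = Any.applyUpTo⁺ (p ^_) (trans a~pⁿ (pⁿ~pⁿ%ˡ n)) (m%n<n n ℓ)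

  ∈⇒IsPower : ∀ {a} → a ∈ powers → IsPower a
  ∈⇒IsPower a∈powers with i , _ , a~pⁱ ← Any.applyUpTo⁻ (p ^_) a∈powers = i , a~pⁱ

  IsPower? : ∀ a → Dec (IsPower a)
  IsPower? a with any? (a ~?_) powers
  ... | yes a∈powers = yes (∈⇒IsPower a∈powers)
  ... | no  a∉powers = no (a∉powers ∘ IsPower⇒∈)

  IsPower-resp : ∀ {a b} → a ~ b → IsPower b → IsPower a
  IsPower-resp a~b (n , b~pⁿ) = n , trans a~b b~pⁿ

  IsPower-* : ∀ {a b} → IsPower a → IsPower b → IsPower (a * b)
  IsPower-* (m , a~pᵐ) (n , b~pⁿ) = m + n , trans (~-* a~pᵐ b~pⁿ) (cong (_% q) (sym (ℕ.^-distribˡ-+-* p m n)))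

  nonpower-exists : ∃ λ c → ¬ c ~ 0 × ¬ IsPower c
  nonpower-exists with All.all? IsPower? residues
  ... | yes all-powers = ⊥-elim (ℕ.<⇒≱ (ℕ.m<m+n ℓ 0<ℓ) (≡.subst₂ _≤_ length-residues (List.length-applyUpTo (p ^_) ℓ)
         (unique⊆⇒length≤ residues! (IsPower⇒∈ ∘ All.lookupₛ ~-setoid (IsPower-resp ∘ sym) all-powers))))
  ... | no ¬all-powers = Any.lookup witness , All.lookupAny residues-nonzero witness
    where
    witness : Any (¬_ ∘ IsPower) residues
    witness = All.¬All⇒Any¬ IsPower? residues ¬all-powers

  module Coset {c} (c≁0 : ¬ c ~ 0) (c∉P : ¬ IsPower c) where

    InCoset : ℕ → Set
    InCoset a = ∃ λ n → a ~ c * p ^ n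

    coset : List ℕ
    coset = applyUpTo (λ i → c * p ^ i) ℓ

    coset! : Unique coset
    coset! = AllPairs.applyUpTo⁺₁ (λ i → c * p ^ i) ℓ (λ i<j j<ℓ → pⁱ≁pʲ i<j j<ℓ ∘ *-cancelˡ-~ c≁0)

    ∈⇒InCoset : ∀ {a} → a ∈ coset → InCoset a
    ∈⇒InCoset a∈coset with i , _ , a~cpⁱ ← Any.applyUpTo⁻ (λ i → c * p ^ i) a∈coset = i , a~cpⁱ

    power∉coset : ∀ {a} → IsPower a → ¬ InCoset a
    power∉coset {a} (m , a~pᵐ) (n , a~cpⁿ) = c∉P (m + (ℓ ∸ 1) * n , *-cancelʳ-~ (pⁿ≁0 n) (begin
      (c * p ^ n) % q                          ≡⟨ trans (sym a~cpⁿ) a~pᵐ ⟩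
      p ^ m % q                                ≡⟨ pᵐ⁺ˡⁿ~pᵐ m n ⟨
      p ^ (m + ℓ * n) % q                      ≡⟨ cong (λ e → p ^ e % q) m+ℓn≡m+[ℓ-1]n+n ⟩
      p ^ (m + (ℓ ∸ 1) * n + n) % q            ≡⟨ cong (_% q) (ℕ.^-distribˡ-+-* p (m + (ℓ ∸ 1) * n) n) ⟩
      (p ^ (m + (ℓ ∸ 1) * n) * p ^ n) % q      ∎))
      where
      m+ℓn≡m+[ℓ-1]n+n : m + ℓ * n ≡ m + (ℓ ∸ 1) * n + n
      m+ℓn≡m+[ℓ-1]n+n = ≡.subst (λ l → m + l * n ≡ m + (l ∸ 1) * n + n) (ℕ.suc-pred ℓ) (arith m (ℓ ∸ 1) n)
        where
        arith : ∀ m k n → m + suc k * n ≡ m + k * n + n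
        arith = solve-∀

    residues↭powers++coset : residues ↭ powers ++ coset
    residues↭powers++coset = unique⊆-length⇒↭ powers++coset! powers++coset⊆residues
      (ℕ.≤-reflexive (trans length-residues (sym (trans (List.length-++ powers)
        (≡.cong₂ _+_ (List.length-applyUpTo (p ^_) ℓ) (List.length-applyUpTo (λ i → c * p ^ i) ℓ))))))
      where
      powers++coset! : Unique (powers ++ coset)
      powers++coset! = AllPairs.++⁺ powers! coset!
        (All.applyUpTo⁺₂ (p ^_) ℓ (λ i → All.applyUpTo⁺₂ (λ j → c * p ^ j) ℓ
          (λ j pⁱ~cpʲ → power∉coset (i , refl) (j , pⁱ~cpʲ))))
      powers++coset⊆residues : powers ++ coset ⊆ residues
      powers++coset⊆residues a∈ with Any.++⁻ powers a∈
      ... | inj₁ a∈powers with n , a~pⁿ ← ∈⇒IsPower a∈powers = ∈-residues (nonzero-resp (sym a~pⁿ) (pⁿ≁0 n))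
      ... | inj₂ a∈coset  with n , a~cpⁿ ← ∈⇒InCoset a∈coset = ∈-residues (nonzero-resp (sym a~cpⁿ) (nonzero-~* c≁0 (pⁿ≁0 n)))

    power-or-coset : ∀ {a} → ¬ a ~ 0 → IsPower a ⊎ InCoset a
    power-or-coset a≁0 with Any.++⁻ powers (∈-resp-↭ residues↭powers++coset (∈-residues a≁0))
    ... | inj₁ a∈powers = inj₁ (∈⇒IsPower a∈powers)
    ... | inj₂ a∈coset  = inj₂ (∈⇒InCoset a∈coset)

    IsPower-*-InCoset : ∀ {a b} → IsPower a → InCoset b → InCoset (a * b)
    IsPower-*-InCoset (m , a~pᵐ) (n , b~cpⁿ) = m + n , trans (~-* a~pᵐ b~cpⁿ) 
      (cong (_% q) (trans (lemma (p ^ m) c (p ^ n)) (cong (c *_) (sym (ℕ.^-distribˡ-+-* p m n)))))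
      where
      lemma : ∀ x c y → x * (c * y) ≡ c * (x * y)
      lemma = solve-∀

    InCoset-*-IsPower : ∀ {a b} → InCoset a → IsPower b → InCoset (a * b)
    InCoset-*-IsPower {a} {b} a∈C b∈P with n , ba~cpⁿ ← IsPower-*-InCoset b∈P a∈C =
      n , trans (cong (_% q) (ℕ.*-comm a b)) ba~cpⁿ

    c²-power : IsPower (c * c)
    c²-power with power-or-coset (nonzero-~* c≁0 c≁0)
    ... | inj₁ c²∈P       = c²∈P
    ... | inj₂ (n , c²~cpⁿ) = ⊥-elim (c∉P (n , *-cancelˡ-~ c≁0 c²~cpⁿ))

    InCoset-*-InCoset : ∀ {a b} → InCoset a → InCoset b → IsPower (a * b)
    InCoset-*-InCoset (m , a~cpᵐ) (n , b~cpⁿ) =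
      IsPower-resp (trans (~-* a~cpᵐ b~cpⁿ) (cong (_% q) (lemma c (p ^ m) (p ^ n))))
                   (IsPower-* c²-power (IsPower-* (m , refl) (n , refl)))
      where
      lemma : ∀ c x y → c * x * (c * y) ≡ c * c * (x * y)
      lemma = solve-∀

  1+[ℓ+ℓ]~0 : suc (ℓ + ℓ) ~ 0
  1+[ℓ+ℓ]~0 = ≡.subst (_~ 0) q≡1+ℓ+ℓ (∣⇒~0 ∣.∣-refl)

  1+a~0⇒a~ℓ+ℓ : ∀ {a} → suc a ~ 0 → a ~ ℓ + ℓ
  1+a~0⇒a~ℓ+ℓ {a} 1+a~0 = begin
    a % q                      ≡⟨ cong (_% q) (ℕ.+-identityʳ a) ⟨
    (a + 0) % q                ≡⟨ ~-+ {a} refl 1+[ℓ+ℓ]~0 ⟨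
    (a + suc (ℓ + ℓ)) % q      ≡⟨ cong (_% q) (ℕ.+-suc a (ℓ + ℓ)) ⟩
    (suc a + (ℓ + ℓ)) % q      ≡⟨ ~-+ 1+a~0 refl ⟩
    (ℓ + ℓ) % q                ∎

  private
    z+z[1+z]≡z[2+z] : ∀ z → z + z * suc z ≡ z * suc (suc z)
    z+z[1+z]≡z[2+z] = solve-∀

  x²~1⇒x~±1 : ∀ {x} → x * x ~ 1 → x ~ 1 ⊎ x ~ ℓ + ℓ
  x²~1⇒x~±1 {zero}  0~1 = ⊥-elim (1≁0 (sym 0~1))
  x²~1⇒x~±1 {suc z} x²~1 with euclidsLemma z (suc (suc z)) q-prime (≡.subst (q ∣_) (z+z[1+z]≡z[2+z] z) (~⇒∣∸ x²~1))
  ... | inj₁ q∣z     = inj₁ (~-+ {1} refl (∣⇒~0 q∣z))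
  ... | inj₂ q∣z+2   = inj₂ (1+a~0⇒a~ℓ+ℓ (∣⇒~0 q∣z+2))

  ℓ-even⇒ℓ+ℓ-power : ∀ m → ℓ ≡ m + m → IsPower (ℓ + ℓ)
  ℓ-even⇒ℓ+ℓ-power m ℓ≡m+m
    with x²~1⇒x~±1 {p ^ m} (trans (cong (_% q) (sym (ℕ.^-distribˡ-+-* p m m))) (≡.subst (λ e → p ^ e ~ 1) ℓ≡m+m pˡ~1))
  ... | inj₁ pᵐ~1   = ⊥-elim (minimal m 0<m (≡.subst (m <_) (sym ℓ≡m+m) (ℕ.m<m+n m 0<m)) (~⇒∣∸ pᵐ~1))
    where
    half-positive : ∀ n → 0 < n + n → 0 < n
    half-positive (suc _) _ = s≤s z≤n
    0<m : 0 < m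
    0<m = half-positive m (≡.subst (0 <_) ℓ≡m+m 0<ℓ)
  ... | inj₂ pᵐ~ℓ+ℓ = m , sym pᵐ~ℓ+ℓ

  [ℓ+ℓ]²~1 : (ℓ + ℓ) * (ℓ + ℓ) ~ 1
  [ℓ+ℓ]²~1 = begin
    (a * a) % q                       ≡⟨ cong (_% q) (trans (ℕ.+-identityʳ (a * a + 0)) (ℕ.+-identityʳ (a * a))) ⟨
    (a * a + 0 + 0) % q               ≡⟨ ~-+ (~-+ {a * a} refl 1+[ℓ+ℓ]~0) 1+[ℓ+ℓ]~0 ⟨
    (a * a + suc a + suc a) % q       ≡⟨ cong (_% q) (square a) ⟩
    (suc a * suc a + 1) % q           ≡⟨ ~-+ (~-* 1+[ℓ+ℓ]~0 1+[ℓ+ℓ]~0) (refl {x = 1 % q}) ⟩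
    1 % q                             ∎
    where
    a = ℓ + ℓ
    square : ∀ a → a * a + suc a + suc a ≡ suc a * suc a + 1
    square = solve-∀

  odd-coprime-2 : ∀ m → Coprime (suc (m + m)) 2
  odd-coprime-2 zero    = Coprime.1-coprimeTo 2
  odd-coprime-2 (suc m) = ≡.subst (λ k → Coprime (suc (suc k)) 2) (sym (ℕ.+-suc m m)) (Coprime.coprime-+ (odd-coprime-2 m))

  ℓ-odd⇒ℓ+ℓ-nonpower : ∀ m → ℓ ≡ suc (m + m) → ¬ IsPower (ℓ + ℓ)
  ℓ-odd⇒ℓ+ℓ-nonpower m ℓ≡1+m+m (n , ℓ+ℓ~pⁿ) = ℕ.<⇒≢ 1<ℓ+ℓ (sym (<-~⇒≡ ℓ+ℓ<q 1<q ℓ+ℓ~1))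
    where
    p²ⁿ~1 : p ^ (n + n) ~ 1
    p²ⁿ~1 = trans (cong (_% q) (ℕ.^-distribˡ-+-* p n n)) (trans (sym (~-* ℓ+ℓ~pⁿ ℓ+ℓ~pⁿ)) [ℓ+ℓ]²~1)
    ℓ∣n : ℓ ∣ n
    ℓ∣n = Coprime.coprime-divisor (≡.subst (λ l → Coprime l 2) (sym ℓ≡1+m+m) (odd-coprime-2 m))
            (≡.subst (ℓ ∣_) (cong (n +_) (sym (ℕ.+-identityʳ n))) (∣.m%n≡0⇒n∣m (n + n) ℓ (pⁿ~1⇒n%ℓ≡0 p²ⁿ~1)))
    ℓ+ℓ~1 : ℓ + ℓ ~ 1
    ℓ+ℓ~1 with divides k n≡kℓ ← ℓ∣n =
      trans ℓ+ℓ~pⁿ (≡.subst (λ e → p ^ e ~ 1) (trans (ℕ.*-comm ℓ k) (sym n≡kℓ)) (pˡᵏ~1 k))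
    ℓ+ℓ<q : ℓ + ℓ < q
    ℓ+ℓ<q = ≡.subst (ℓ + ℓ <_) (sym q≡1+ℓ+ℓ) (ℕ.n<1+n (ℓ + ℓ))
    1<ℓ+ℓ : 1 < ℓ + ℓ
    1<ℓ+ℓ = ℕ.+-mono-≤ 0<ℓ 0<ℓ

  residues⁻ : List ℕ
  residues⁻ = applyUpTo suc (ℓ + ℓ ∸ 1)

  private
    1+[ℓ+ℓ∸1]≡ℓ+ℓ : suc (ℓ + ℓ ∸ 1) ≡ ℓ + ℓ
    1+[ℓ+ℓ∸1]≡ℓ+ℓ = ℕ.suc-pred (ℓ + ℓ) {{ℕ.>-nonZero (ℕ.≤-trans 0<ℓ (ℕ.m≤m+n ℓ ℓ))}}

  residues≡residues⁻++[ℓ+ℓ] : residues ≡ residues⁻ ++ (ℓ + ℓ) ∷ []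
  residues≡residues⁻++[ℓ+ℓ] = ≡.subst (λ n → applyUpTo suc n ≡ residues⁻ ++ n ∷ [])
    1+[ℓ+ℓ∸1]≡ℓ+ℓ (sym (List.applyUpTo-∷ʳ suc (ℓ + ℓ ∸ 1)))

  residues⁻-successors-nonzero : All (λ c → ¬ suc c ~ 0) residues⁻
  residues⁻-successors-nonzero = All.applyUpTo⁺₁ suc (ℓ + ℓ ∸ 1)
    (λ {i} i<ℓ+ℓ-1 → All.applyUpTo⁻ suc (ℓ + ℓ) residues-nonzero (≡.subst (suc i <_) 1+[ℓ+ℓ∸1]≡ℓ+ℓ (s≤s i<ℓ+ℓ-1)))

module GaussPeriods (L : FiniteField) (p q ℓ : ℕ) (p-prime : Prime p) (char∣p : FiniteFieldProperties.CharacteristicDivides L p)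
  (q-prime : Prime q) (q≡2ℓ+1 : 2 ℕ.* ℓ ℕ.+ 1 ≡ q) (p-order : MultiplicativeOrder p q ℓ) where

  open FiniteField L
  open CommutativeRing ring hiding (ring)
  open IntegerCoefficientSolver ring using (fromℕ)

  open import Data.Nat as ℕ using (zero; suc; _%_; _/_)
  import Data.Nat.Properties as ℕ
  open import Data.Nat.DivMod using (m≡m%n+[m/n]*n)
  open import Data.Nat.Primality using (prime⇒nonZero)
  open import Data.List using (List; []; _∷_; length; applyUpTo; map; upTo)
  import Data.List.Properties as List
  open import Data.List.Relation.Unary.All as All using (All; []; _∷_)
  import Data.List.Relation.Unary.All.Properties as All
  open import Data.Product using (_,_)
  open import Data.Sum using (inj₁; inj₂)
  open import Data.Empty using (⊥-elim)
  open import Function using (_∘_)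
  open import Relation.Nullary using (¬_; yes; no)
  import Relation.Binary.PropositionalEquality as ≡

  open IntegerCoefficientSolver ring using (fromℕ-suc; solve; _:+_; _:-_; _:*_; :-_; _:=_; :0; :1)
  open RingListSum ring
    using (∑; ∑-cong; ∑-cong-All; ∑-++; ∑-map; ∑-↭; ∑-applyUpTo; ∑-*ˡ; ∑-*ʳ; ∑-‿; ∑-const; ∑-*; ∑-swap)
  open FiniteFieldProperties L
  open PrimeCharacteristic L p p-prime char∣p using (∑-frobenius)
  open import Algebra.Properties.Ring (CommutativeRing.ring ring)
    using (-1*x≈-x; +-inverseʳ-unique; +-inverseˡ-unique; x≈y⇒x∙y⁻¹≈ε; x∙y⁻¹≈ε⇒x≈y)
  open import Relation.Binary.Reasoning.Setoid setoid

  instance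
    p≢0 : NonZero p
    p≢0 = prime⇒nonZero p-prime

  open Residues p q ℓ q-prime q≡2ℓ+1 p-order
  open Congruence q using (_~_; ~-setoid; module PrimeModulus)
  open PrimeModulus q-prime using (*-cancelʳ-~)

  trace≈∑ : ∀ k y → trace L p k y ≈ ∑ (y ^_) (applyUpTo (p ℕ.^_) k)
  trace≈∑ zero    y = refl
  trace≈∑ (suc k) y = +-cong (sym (*-identityʳ y)) (begin
    trace L p k (pow L y p)                          ≡⟨ ≡.cong (trace L p k) (pow≡^ y p) ⟩
    trace L p k (y ^ p)                              ≈⟨ trace≈∑ k (y ^ p) ⟩
    ∑ ((y ^ p) ^_) (applyUpTo (p ℕ.^_) k)            ≡⟨ ∑-applyUpTo _ (p ℕ.^_) k ⟩
    ∑ (λ i → (y ^ p) ^ p ℕ.^ i) (upTo k)             ≈⟨ ∑-cong (upTo k) (λ i → ^-assocʳ y p (p ℕ.^ i)) ⟩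
    ∑ (λ i → y ^ p ℕ.^ suc i) (upTo k)               ≡⟨ ∑-applyUpTo _ (λ i → p ℕ.^ suc i) k ⟨
    ∑ (y ^_) (applyUpTo (λ i → p ℕ.^ suc i) k)       ∎)

  trace-cong : ∀ k {y y′} → y ≈ y′ → trace L p k y ≈ trace L p k y′
  trace-cong k {y} {y′} y≈y′ =
    trans (trace≈∑ k y) (trans (∑-cong (applyUpTo (p ℕ.^_) k) (λ a → ^-congˡ a y≈y′)) (sym (trace≈∑ k y′)))

  trace-1 : ∀ k → trace L p k 1# ≈ fromℕ k
  trace-1 k = begin
    trace L p k 1#                            ≈⟨ trace≈∑ k 1# ⟩
    ∑ (1# ^_) (applyUpTo (p ℕ.^_) k)          ≈⟨ ∑-cong (applyUpTo (p ℕ.^_) k) 1^n≈1 ⟩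
    ∑ (λ _ → 1#) (applyUpTo (p ℕ.^_) k)       ≈⟨ ∑-const 1# (applyUpTo (p ℕ.^_) k) ⟩
    fromℕ (length (applyUpTo (p ℕ.^_) k)) * 1# ≈⟨ *-identityʳ _ ⟩
    fromℕ (length (applyUpTo (p ℕ.^_) k))      ≡⟨ ≡.cong fromℕ (List.length-applyUpTo _ k) ⟩
    fromℕ k                                   ∎

  module RootOfUnity {y} (y^q≈1 : y ^ q ≈ 1#) where

    y^%q : ∀ a → y ^ a ≈ y ^ (a % q)
    y^%q a = begin
      y ^ a
        ≡⟨ ≡.cong (y ^_) (≡.trans (m≡m%n+[m/n]*n a q) (≡.cong (a % q ℕ.+_) (ℕ.*-comm (a / q) q))) ⟩
      y ^ (a % q ℕ.+ q ℕ.* (a / q))           ≈⟨ ^-homo-* y (a % q) _ ⟩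
      y ^ (a % q) * y ^ (q ℕ.* (a / q))       ≈⟨ *-congˡ (sym (^-assocʳ y q (a / q))) ⟩
      y ^ (a % q) * (y ^ q) ^ (a / q)         ≈⟨ *-congˡ (trans (^-congˡ (a / q) y^q≈1) (1^n≈1 (a / q))) ⟩
      y ^ (a % q) * 1#                        ≈⟨ *-identityʳ _ ⟩
      y ^ (a % q)                             ∎

    ^-cong-~ : ∀ {a b} → a ~ b → y ^ a ≈ y ^ b
    ^-cong-~ {a} {b} a~b = trans (y^%q a) (trans (reflexive (≡.cong (y ^_) a~b)) (sym (y^%q b)))

    trace-fixed : trace L p ℓ y ^ p ≈ trace L p ℓ y
    trace-fixed = begin
      trace L p ℓ y ^ p                   ≈⟨ ^-congˡ p (trace≈∑ ℓ y) ⟩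
      ∑ (y ^_) powers ^ p                 ≈⟨ ∑-frobenius (y ^_) powers ⟩
      ∑ (λ a → (y ^ a) ^ p) powers        ≈⟨ ∑-cong powers (λ a → ^-assocʳ y a p) ⟩
      ∑ (λ a → y ^ (a ℕ.* p)) powers      ≈⟨ ∑-map (y ^_) (ℕ._* p) powers ⟨
      ∑ (y ^_) (map (ℕ._* p) powers)      ≈⟨ ∑-↭ ~-setoid ^-cong-~ powers↭powers*p ⟨
      ∑ (y ^_) powers                     ≈⟨ trace≈∑ ℓ y ⟨
      trace L p ℓ y                       ∎
      where
      open import Data.List.Relation.Binary.Permutation.Setoid ~-setoid using (_↭_)
      open UniqueSublist ~-setoid using (self-injection⇒↭)
      powers↭powers*p : powers ↭ map (ℕ._* p) powers
      powers↭powers*p = self-injection⇒↭ (*-cancelʳ-~ p≁0) powers!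
        (λ a∈powers → IsPower⇒∈ (IsPower-* (∈⇒IsPower a∈powers) (1 , ≡.cong (_% q) (≡.sym (ℕ.*-identityʳ p)))))

    ∑-residues : ¬ y ≈ 1# → ∑ (y ^_) residues ≈ - 1#
    ∑-residues y≉1 = +-inverseʳ-unique 1# _ (*≈0⇒≈0 y-1≉0 (begin
      (y - 1#) * ∑ (y ^_) (upTo (suc (ℓ ℕ.+ ℓ)))   ≡⟨ ≡.cong (λ n → (y - 1#) * ∑ (y ^_) (upTo n)) q≡1+ℓ+ℓ ⟨
      (y - 1#) * ∑ (y ^_) (upTo q)                 ≈⟨ geometric-sum y q ⟩
      y ^ q - 1#                                   ≈⟨ x≈y⇒x∙y⁻¹≈ε y^q≈1 ⟩
      0#                                           ∎))
      where
      y-1≉0 : ¬ y - 1# ≈ 0#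
      y-1≉0 = y≉1 ∘ x∙y⁻¹≈ε⇒x≈y y 1#

  -- χ is the quadratic character modulo q: the powers of p are the squares.
  χ : ℕ → Carrier
  χ a with IsPower? a
  ... | yes _ = 1#
  ... | no  _ = - 1#

  χ-power : ∀ {a} → IsPower a → χ a ≈ 1#
  χ-power {a} a∈P with IsPower? a
  ... | yes _   = refl
  ... | no  a∉P = ⊥-elim (a∉P a∈P)

  χ-nonpower : ∀ {a} → ¬ IsPower a → χ a ≈ - 1#
  χ-nonpower {a} a∉P with IsPower? a
  ... | yes a∈P = ⊥-elim (a∉P a∈P)
  ... | no  _   = refl

  χ-cong : ∀ {a b} → a ~ b → χ a ≈ χ b
  χ-cong {a} {b} a~b with IsPower? b
  ... | yes b∈P = χ-power (IsPower-resp a~b b∈P)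
  ... | no  b∉P = χ-nonpower (b∉P ∘ IsPower-resp (≡.sym a~b))

  χ²≈1 : ∀ a → χ a * χ a ≈ 1#
  χ²≈1 a with IsPower? a
  ... | yes _ = *-identityˡ 1#
  ... | no  _ = solve 0 (:- :1 :* :- :1 := :1) refl

  module Gauss {c} (c≁0 : ¬ c ~ 0) (c∉P : ¬ IsPower c) where
    open Coset c≁0 c∉P

    χ-coset : ∀ {a} → InCoset a → χ a ≈ - 1#
    χ-coset a∈C = χ-nonpower (λ a∈P → power∉coset a∈P a∈C)

    χ-* : ∀ {a b} → ¬ a ~ 0 → ¬ b ~ 0 → χ (a ℕ.* b) ≈ χ a * χ b
    χ-* a≁0 b≁0 with power-or-coset a≁0 | power-or-coset b≁0
    ... | inj₁ a∈P | inj₁ b∈P =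
      trans (χ-power (IsPower-* a∈P b∈P)) (sym (trans (*-cong (χ-power a∈P) (χ-power b∈P)) (*-identityˡ 1#)))
    ... | inj₁ a∈P | inj₂ b∈C =
      trans (χ-coset (IsPower-*-InCoset a∈P b∈C)) (sym (trans (*-cong (χ-power a∈P) (χ-coset b∈C)) (*-identityˡ _)))
    ... | inj₂ a∈C | inj₁ b∈P =
      trans (χ-coset (InCoset-*-IsPower a∈C b∈P)) (sym (trans (*-cong (χ-coset a∈C) (χ-power b∈P)) (*-identityʳ _)))
    ... | inj₂ a∈C | inj₂ b∈C =
      trans (χ-power (InCoset-*-InCoset a∈C b∈C)) (sym (trans (*-cong (χ-coset a∈C) (χ-coset b∈C)) (solve 0 (:- :1 :* :- :1 := :1) refl)))

    ∑-residues≈powers+coset : ∀ f → (∀ {a b} → a ~ b → f a ≈ f b) → ∑ f residues ≈ ∑ f powers + ∑ f coset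
    ∑-residues≈powers+coset f f-cong = trans (∑-↭ ~-setoid f-cong residues↭powers++coset) (∑-++ f powers coset)

    ∑χ≈0 : ∑ χ residues ≈ 0#
    ∑χ≈0 = begin
      ∑ χ residues                                 ≈⟨ ∑-residues≈powers+coset χ χ-cong ⟩
      ∑ χ powers + ∑ χ coset                       ≈⟨ +-cong (∑-cong-All powers (All.applyUpTo⁺₂ (p ℕ.^_) ℓ (λ i → χ-power (i , ≡.refl))))
                                                             (∑-cong-All coset (All.applyUpTo⁺₂ _ ℓ (λ i → χ-coset (i , ≡.refl)))) ⟩
      ∑ (λ _ → 1#) powers + ∑ (λ _ → - 1#) coset   ≈⟨ +-cong (∑-const 1# powers) (∑-const (- 1#) coset) ⟩
      fromℕ (length powers) * 1# + fromℕ (length coset) * - 1#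
        ≡⟨ ≡.cong₂ (λ m n → fromℕ m * 1# + fromℕ n * - 1#) (List.length-applyUpTo _ ℓ) (List.length-applyUpTo _ ℓ) ⟩
      fromℕ ℓ * 1# + fromℕ ℓ * - 1#               ≈⟨ solve 1 (λ n → n :* :1 :+ n :* :- :1 := :0) refl (fromℕ ℓ) ⟩
      0#                                           ∎

    module Primitive {x} (x^q≈1 : x ^ q ≈ 1#) (x≉1 : ¬ x ≈ 1#) where
      open RootOfUnity x^q≈1

      x^a≉1 : ∀ {a} → ¬ a ~ 0 → ¬ x ^ a ≈ 1#
      x^a≉1 {a} a≁0 x^a≈1 with b , ab~1 ← ~-inverse a≁0 = x≉1 (begin
        x               ≈⟨ *-identityʳ x ⟨
        x ^ 1           ≈⟨ ^-cong-~ (≡.sym ab~1) ⟩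
        x ^ (a ℕ.* b)   ≈⟨ ^-assocʳ x a b ⟨
        (x ^ a) ^ b     ≈⟨ ^-congˡ b x^a≈1 ⟩
        1# ^ b          ≈⟨ 1^n≈1 b ⟩
        1#              ∎)

      x^a^q≈1 : ∀ a → (x ^ a) ^ q ≈ 1#
      x^a^q≈1 a = begin
        (x ^ a) ^ q     ≈⟨ ^-assocʳ x a q ⟩
        x ^ (a ℕ.* q)   ≡⟨ ≡.cong (x ^_) (ℕ.*-comm a q) ⟩
        x ^ (q ℕ.* a)   ≈⟨ ^-assocʳ x q a ⟨
        (x ^ q) ^ a     ≈⟨ ^-congˡ a x^q≈1 ⟩
        1# ^ a          ≈⟨ 1^n≈1 a ⟩
        1#              ∎

      g : Carrier
      g = ∑ (λ a → χ a * x ^ a) residues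

      S : ℕ → Carrier
      S c = ∑ ((x ^ suc c) ^_) residues

      S≈-1 : ∀ {c} → ¬ suc c ~ 0 → S c ≈ - 1#
      S≈-1 {c} 1+c≁0 = RootOfUnity.∑-residues (x^a^q≈1 (suc c)) (x^a≉1 1+c≁0)

      S[ℓ+ℓ]≈ℓ+ℓ : S (ℓ ℕ.+ ℓ) ≈ fromℕ (ℓ ℕ.+ ℓ)
      S[ℓ+ℓ]≈ℓ+ℓ = begin
        ∑ ((x ^ suc (ℓ ℕ.+ ℓ)) ^_) residues    ≈⟨ ∑-cong residues (λ a → ^-congˡ a x^[1+ℓ+ℓ]≈1) ⟩
        ∑ (1# ^_) residues                      ≈⟨ ∑-cong residues 1^n≈1 ⟩
        ∑ (λ _ → 1#) residues                   ≈⟨ ∑-const 1# residues ⟩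
        fromℕ (length residues) * 1#            ≈⟨ *-identityʳ _ ⟩
        fromℕ (length residues)                 ≡⟨ ≡.cong fromℕ length-residues ⟩
        fromℕ (ℓ ℕ.+ ℓ)                         ∎
        where
        x^[1+ℓ+ℓ]≈1 : x ^ suc (ℓ ℕ.+ ℓ) ≈ 1#
        x^[1+ℓ+ℓ]≈1 = trans (reflexive (≡.cong (x ^_) (≡.sym q≡1+ℓ+ℓ))) x^q≈1

      ∑-reindex : ∀ {a} → ¬ a ~ 0 →
                  ∑ (λ b → (χ a * x ^ a) * (χ b * x ^ b)) residues ≈ ∑ (λ c → χ c * x ^ (a ℕ.* suc c)) residues
      ∑-reindex {a} a≁0 = begin
        ∑ F residues                  ≈⟨ ∑-↭ ~-setoid F-cong (residues↭a*residues a≁0) ⟩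
        ∑ F (map (a ℕ.*_) residues)   ≈⟨ ∑-map F (a ℕ.*_) residues ⟩
        ∑ (F ∘ (a ℕ.*_)) residues     ≈⟨ ∑-cong-All residues (All.map F[a*c]≈ residues-nonzero) ⟩
        ∑ (λ c → χ c * x ^ (a ℕ.* suc c)) residues ∎
        where
        F : ℕ → Carrier
        F b = (χ a * x ^ a) * (χ b * x ^ b)
        F-cong : ∀ {b b′} → b ~ b′ → F b ≈ F b′
        F-cong b~b′ = *-congˡ (*-cong (χ-cong b~b′) (^-cong-~ b~b′))
        F[a*c]≈ : ∀ {c} → ¬ c ~ 0 → F (a ℕ.* c) ≈ χ c * x ^ (a ℕ.* suc c)
        F[a*c]≈ {c} c≁0 = begin
          (χ a * x ^ a) * (χ (a ℕ.* c) * x ^ (a ℕ.* c))     ≈⟨ *-congˡ (*-congʳ (χ-* a≁0 c≁0)) ⟩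
          (χ a * x ^ a) * ((χ a * χ c) * x ^ (a ℕ.* c))     ≈⟨ solve 4 (λ u X v Y → (u :* X) :* ((u :* v) :* Y) := ((u :* u) :* v) :* (X :* Y)) refl (χ a) (x ^ a) (χ c) (x ^ (a ℕ.* c)) ⟩
          ((χ a * χ a) * χ c) * (x ^ a * x ^ (a ℕ.* c))     ≈⟨ *-cong (trans (*-congʳ (χ²≈1 a)) (*-identityˡ _)) (sym (^-homo-* x a (a ℕ.* c))) ⟩
          χ c * x ^ (a ℕ.+ a ℕ.* c)                         ≡⟨ ≡.cong (λ e → χ c * x ^ e) (ℕ.*-suc a c) ⟨
          χ c * x ^ (a ℕ.* suc c)                           ∎

      g²≈∑χS : g * g ≈ ∑ (λ c → χ c * S c) residues
      g²≈∑χS = begin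
        g * g                                                                 ≈⟨ ∑-* _ _ residues residues ⟩
        ∑ (λ a → ∑ (λ b → (χ a * x ^ a) * (χ b * x ^ b)) residues) residues  ≈⟨ ∑-cong-All residues (All.map ∑-reindex residues-nonzero) ⟩
        ∑ (λ a → ∑ (λ c → χ c * x ^ (a ℕ.* suc c)) residues) residues        ≈⟨ ∑-swap _ residues residues ⟩
        ∑ (λ c → ∑ (λ a → χ c * x ^ (a ℕ.* suc c)) residues) residues        ≈⟨ ∑-cong residues inner ⟩
        ∑ (λ c → χ c * S c) residues                                          ∎
        where
        inner : ∀ c → ∑ (λ a → χ c * x ^ (a ℕ.* suc c)) residues ≈ χ c * S c
        inner c = trans (∑-cong residues (λ a → *-congˡ (trans (reflexive (≡.cong (x ^_) (ℕ.*-comm a (suc c)))) (sym (^-assocʳ x (suc c) a)))))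
                        (∑-*ˡ (χ c) _ residues)

      g²≈χ[ℓ+ℓ]q : g * g ≈ χ (ℓ ℕ.+ ℓ) * fromℕ q
      g²≈χ[ℓ+ℓ]q = begin
        g * g                                                          ≈⟨ g²≈∑χS ⟩
        ∑ (λ c → χ c * S c) residues                                   ≈⟨ ∑-residues-split (λ c → χ c * S c) ⟩
        ∑ (λ c → χ c * S c) residues⁻ + χ ε * S ε                      ≈⟨ +-cong (∑-cong-All residues⁻ (All.map (*-congˡ ∘ S≈-1) residues⁻-successors-nonzero))
                                                                                  (*-congˡ S[ℓ+ℓ]≈ℓ+ℓ) ⟩
        ∑ (λ c → χ c * - 1#) residues⁻ + χ ε * fromℕ ε                ≈⟨ +-congʳ (∑-*ʳ (- 1#) χ residues⁻) ⟩
        ∑ χ residues⁻ * - 1# + χ ε * fromℕ ε                          ≈⟨ +-congʳ (*-congʳ ∑χ⁻≈-χε) ⟩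
        - χ ε * - 1# + χ ε * fromℕ ε                                   ≈⟨ solve 2 (λ e n → :- e :* :- :1 :+ e :* n := e :* (:1 :+ n)) refl (χ ε) (fromℕ ε) ⟩
        χ ε * (1# + fromℕ ε)                                           ≈⟨ *-congˡ (fromℕ-suc ε) ⟨
        χ ε * fromℕ (suc ε)                                            ≡⟨ ≡.cong (λ n → χ ε * fromℕ n) q≡1+ℓ+ℓ ⟨
        χ ε * fromℕ q                                                  ∎
        where
        ε = ℓ ℕ.+ ℓ
        ∑-residues-split : ∀ f → ∑ f residues ≈ ∑ f residues⁻ + f ε
        ∑-residues-split f = trans (reflexive (≡.cong (∑ f) residues≡residues⁻++[ℓ+ℓ]))
                                   (trans (∑-++ f residues⁻ (ε ∷ [])) (+-congˡ (+-identityʳ (f ε))))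
        ∑χ⁻≈-χε : ∑ χ residues⁻ ≈ - χ ε
        ∑χ⁻≈-χε = +-inverseˡ-unique _ _ (trans (sym (∑-residues-split χ)) ∑χ≈0)

      trace-x≈∑powers : trace L p ℓ x ≈ ∑ (x ^_) powers
      trace-x≈∑powers = trace≈∑ ℓ x

      trace-x^c≈∑coset : trace L p ℓ (x ^ c) ≈ ∑ (x ^_) coset
      trace-x^c≈∑coset = begin
        trace L p ℓ (x ^ c)                          ≈⟨ trace≈∑ ℓ (x ^ c) ⟩
        ∑ ((x ^ c) ^_) powers                        ≡⟨ ∑-applyUpTo _ (p ℕ.^_) ℓ ⟩
        ∑ (λ i → (x ^ c) ^ p ℕ.^ i) (upTo ℓ)         ≈⟨ ∑-cong (upTo ℓ) (λ i → ^-assocʳ x c (p ℕ.^ i)) ⟩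
        ∑ (λ i → x ^ (c ℕ.* p ℕ.^ i)) (upTo ℓ)       ≡⟨ ∑-applyUpTo _ (λ i → c ℕ.* p ℕ.^ i) ℓ ⟨
        ∑ (x ^_) coset                               ∎

      periods-sum : trace L p ℓ x + trace L p ℓ (x ^ c) ≈ - 1#
      periods-sum = begin
        trace L p ℓ x + trace L p ℓ (x ^ c)   ≈⟨ +-cong trace-x≈∑powers trace-x^c≈∑coset ⟩
        ∑ (x ^_) powers + ∑ (x ^_) coset      ≈⟨ ∑-residues≈powers+coset (x ^_) ^-cong-~ ⟨
        ∑ (x ^_) residues                     ≈⟨ ∑-residues x≉1 ⟩
        - 1#                                  ∎

      periods-difference≈g : trace L p ℓ x - trace L p ℓ (x ^ c) ≈ g
      periods-difference≈g = begin
        trace L p ℓ x - trace L p ℓ (x ^ c)                         ≈⟨ +-cong trace-x≈∑powers (-‿cong trace-x^c≈∑coset) ⟩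
        ∑ (x ^_) powers - ∑ (x ^_) coset                            ≈⟨ +-cong (∑-cong-All powers (All.applyUpTo⁺₂ _ ℓ on-powers))
                                                                               (trans (∑-cong-All coset (All.applyUpTo⁺₂ _ ℓ on-coset)) (∑-‿ (x ^_) coset)) ⟨
        ∑ (λ a → χ a * x ^ a) powers + ∑ (λ a → χ a * x ^ a) coset  ≈⟨ ∑-residues≈powers+coset _ (λ a~b → *-cong (χ-cong a~b) (^-cong-~ a~b)) ⟨
        g                                                           ∎
        where
        on-powers : ∀ i → χ (p ℕ.^ i) * x ^ p ℕ.^ i ≈ x ^ p ℕ.^ i
        on-powers i = trans (*-congʳ (χ-power (i , ≡.refl))) (*-identityˡ _)
        on-coset : ∀ i → χ (c ℕ.* p ℕ.^ i) * x ^ (c ℕ.* p ℕ.^ i) ≈ - x ^ (c ℕ.* p ℕ.^ i)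
        on-coset i = trans (*-congʳ (χ-coset (i , ≡.refl))) (-1*x≈-x _)

      periods-difference² : (trace L p ℓ x - trace L p ℓ (x ^ c)) * (trace L p ℓ x - trace L p ℓ (x ^ c)) ≈ χ (ℓ ℕ.+ ℓ) * fromℕ q
      periods-difference² = trans (*-cong periods-difference≈g periods-difference≈g) g²≈χ[ℓ+ℓ]q

module FilterCount where

  open import Data.Nat using (ℕ; _<_)
  import Data.Nat.Properties as ℕ
  open import Data.List using (List; length; filter; upTo)
  open import Data.List.Relation.Unary.Any as Any using ()
  import Data.List.Relation.Unary.Any.Properties as Any
  import Data.List.Relation.Unary.AllPairs.Properties as AllPairs
  open import Data.List.Membership.Propositional using (_∈_)
  open import Data.List.Membership.Propositional.Properties using (∈-filter⁺; ∈-filter⁻)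
  open import Data.List.Relation.Unary.Unique.Propositional using (Unique)
  open import Data.Product using (_×_; _,_; proj₁; proj₂)
  open import Function using (id)
  open import Relation.Unary using (Pred; Decidable)
  open import Relation.Binary.PropositionalEquality as ≡ using (_≡_)
  open UniqueSublist (≡.setoid ℕ) using (unique⊆⇒length≤)

  length-filter-upTo : ∀ {p} {P : Pred ℕ p} (P? : Decidable P) n {S : List ℕ} → Unique S →
                       (∀ {k} → k < n → P k → k ∈ S) → (∀ {k} → k ∈ S → k < n × P k) →
                       length (filter P? (upTo n)) ≡ length S
  length-filter-upTo P? n {S} S! into-S from-S = ℕ.≤-antisym
    (unique⊆⇒length≤ (AllPairs.filter⁺ P? upTo!) filter⊆S)
    (unique⊆⇒length≤ S! S⊆filter)
    where
    upTo! : Unique (upTo n)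
    upTo! = AllPairs.applyUpTo⁺₁ id n (λ i<j _ → ℕ.<⇒≢ i<j)
    filter⊆S : ∀ {k} → k ∈ filter P? (upTo n) → k ∈ S
    filter⊆S k∈filter with k∈upTo , Pk ← ∈-filter⁻ P? {xs = upTo n} k∈filter
                       with i , i<n , ≡.refl ← Any.applyUpTo⁻ id k∈upTo = into-S i<n Pk
    S⊆filter : ∀ {k} → k ∈ S → k ∈ filter P? (upTo n)
    S⊆filter k∈S = ∈-filter⁺ P? (Any.applyUpTo⁺ id ≡.refl (proj₁ (from-S k∈S))) (proj₂ (from-S k∈S))

module TraceSet (L : FiniteField) (p q ℓ : ℕ) (p-prime : Prime p) (p-odd : p ℕ.% 2 ≡ 1)
  (q-prime : Prime q) (q≡2ℓ+1 : 2 ℕ.* ℓ ℕ.+ 1 ≡ q) (p-order : MultiplicativeOrder p q ℓ)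
  (card≡pˡ : card L ≡ p ℕ.^ ℓ) where

  open import Data.Nat as ℕ using (zero; suc; _%_; _<_; z≤n; s≤s)
  import Data.Nat.Properties as ℕ
  open import Data.Nat.DivMod using (m%n<n; [m+kn]%n≡m%n)
  open import Data.Nat.Divisibility as ∣ using (_∣_)
  open import Data.Nat.Primality using (prime⇒nonZero; prime⇒irreducible)
  open import Data.Nat.Tactic.RingSolver using (solve-∀)
  open import Data.Integer as ℤ using (+_)
  import Data.Integer.Divisibility as ℤ
  open import Data.Bool using (if_then_else_)
  open import Data.List using ([]; _∷_)
  open import Data.List.Relation.Unary.Any as Any using (Any; here; there)
  open import Data.List.Relation.Unary.All using ([]; _∷_)
  open import Data.List.Relation.Unary.AllPairs using ([]; _∷_)
  open import Data.List.Membership.Propositional using (_∈_)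
  open import Data.Product using (∃; _×_; _,_)
  open import Data.Sum as Sum using (_⊎_; inj₁; inj₂; [_,_]′)
  open import Function using (_∘_; flip; _⇔_; mk⇔)
  open import Relation.Nullary using (¬_; Dec; yes; no)
  open import Relation.Nullary.Decidable using (dec-true; dec-false)
  import Relation.Binary.PropositionalEquality as ≡

  open FiniteField L
  open CommutativeRing ring hiding (ring)
  open IntegerCoefficientSolver ring using (fromℕ; fromℕ-suc; fromℕ-+; solve; _:+_; _:-_; _:*_; :-_; _:=_; :0; :1)
  open import Relation.Binary.Reasoning.Setoid setoid
  open import Algebra.Properties.Ring (CommutativeRing.ring ring) using (x≈y⇒x∙y⁻¹≈ε; x∙y⁻¹≈ε⇒x≈y; +-cancelʳ)
  open PrimeBinomial using (prime⇒1<p)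
  open FilterCount using (length-filter-upTo)
  open FiniteFieldProperties L

  char∣p : CharacteristicDivides p
  char∣p = card≡pⁿ⇒char∣p {p} {ℓ} card≡pˡ

  instance
    p≢0 : NonZero p
    p≢0 = prime⇒nonZero p-prime

  open PrimeCharacteristic L p p-prime char∣p
  open GaussPeriods L p q ℓ p-prime char∣p q-prime q≡2ℓ+1 p-order
  open Residues p q ℓ q-prime q≡2ℓ+1 p-order
  open Congruence q using (_~_; ∣⇒~0)

  PeriodValue : Carrier → Set
  PeriodValue t = (t + t + 1#) * (t + t + 1#) ≈ χ (ℓ ℕ.+ ℓ) * fromℕ q

  PeriodValue-resp : ∀ {t s} → t ≈ s → PeriodValue s → PeriodValue t
  PeriodValue-resp {t} {s} t≈s = trans (*-cong 2t+1≈2s+1 2t+1≈2s+1)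
    where
    2t+1≈2s+1 : t + t + 1# ≈ s + s + 1#
    2t+1≈2s+1 = +-congʳ (+-cong t≈s t≈s)

  double-injective : ∀ {t s} → t + t ≈ s + s → t ≈ s
  double-injective {t} {s} t+t≈s+s = *-cancelˡ-nonzero (fromℕ-nonzero (s≤s z≤n) 2<p) (begin
    fromℕ 2 * t  ≈⟨ solve 1 (λ t → (:1 :+ :1) :* t := t :+ t) refl t ⟩
    t + t        ≈⟨ t+t≈s+s ⟩
    s + s        ≈⟨ solve 1 (λ t → t :+ t := (:1 :+ :1) :* t) refl s ⟩
    fromℕ 2 * s  ∎)
    where
    odd-prime⇒2<p : ∀ n → 1 < n → n % 2 ≡ 1 → 2 < n
    odd-prime⇒2<p (suc zero)          (s≤s ()) _
    odd-prime⇒2<p (suc (suc zero))    _ ()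
    odd-prime⇒2<p (suc (suc (suc _))) _ _ = s≤s (s≤s (s≤s z≤n))
    2<p : 2 < p
    2<p = odd-prime⇒2<p p (prime⇒1<p p-prime) p-odd

  q≉0 : ¬ fromℕ q ≈ 0#
  q≉0 q≈0 with prime⇒irreducible q-prime (fromℕ≈0⇒∣ q≈0)
  ... | inj₁ p≡1 = ℕ.<-irrefl (≡.sym p≡1) (prime⇒1<p p-prime)
  ... | inj₂ p≡q = p≁0 (∣⇒~0 (≡.subst (q ∣_) (≡.sym p≡q) ∣.∣-refl))

  parity : ∀ n → (∃ λ m → n ≡ m ℕ.+ m) ⊎ (∃ λ m → n ≡ suc (m ℕ.+ m))
  parity zero    = inj₁ (0 , ≡.refl)
  parity (suc n) with parity n
  ... | inj₁ (m , n≡2m)   = inj₂ (m , ≡.cong suc n≡2m)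
  ... | inj₂ (m , n≡2m+1) = inj₁ (suc m , ≡.cong suc (≡.trans n≡2m+1 (≡.sym (ℕ.+-suc m m))))

  fromℕ-q : fromℕ q ≈ 1# + fromℕ (ℓ ℕ.+ ℓ)
  fromℕ-q = trans (reflexive (≡.cong fromℕ q≡1+ℓ+ℓ)) (fromℕ-suc (ℓ ℕ.+ ℓ))

  |q*-1|≈q-χ[ℓ+ℓ] : ∃ λ n → ℤ.∣ qStar q ℤ.- + 1 ∣ ≡ n × fromℕ n ≈ fromℕ q - χ (ℓ ℕ.+ ℓ)
  |q*-1|≈q-χ[ℓ+ℓ] with parity ℓ
  ... | inj₁ (m , ℓ≡m+m) = ℓ ℕ.+ ℓ , |q*-1|≡ℓ+ℓ , (begin
    fromℕ (ℓ ℕ.+ ℓ)                   ≈⟨ solve 1 (λ a → a := (:1 :+ a) :- :1) refl (fromℕ (ℓ ℕ.+ ℓ)) ⟩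
    (1# + fromℕ (ℓ ℕ.+ ℓ)) - 1#       ≈⟨ +-cong fromℕ-q (-‿cong (χ-power (ℓ-even⇒ℓ+ℓ-power m ℓ≡m+m))) ⟨
    fromℕ q - χ (ℓ ℕ.+ ℓ)             ∎)
    where
    q%4≡1 : q % 4 ≡ 1
    q%4≡1 = ≡.trans (≡.cong (_% 4) (≡.trans q≡1+ℓ+ℓ (≡.cong (λ l → suc (l ℕ.+ l)) ℓ≡m+m)))
                    (≡.trans (≡.cong (λ n → suc n % 4) (4m≡ m)) ([m+kn]%n≡m%n 1 m 4))
      where
      4m≡ : ∀ m → (m ℕ.+ m) ℕ.+ (m ℕ.+ m) ≡ m ℕ.* 4
      4m≡ = solve-∀
    |q*-1|≡ℓ+ℓ : ℤ.∣ qStar q ℤ.- + 1 ∣ ≡ ℓ ℕ.+ ℓ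
    |q*-1|≡ℓ+ℓ = ≡.trans (≡.cong (λ b → ℤ.∣ (if b then + q else ℤ.- + q) ℤ.- + 1 ∣) (dec-true (q % 4 ℕ.≟ 1) q%4≡1))
                         (≡.cong (λ n → ℤ.∣ + n ℤ.- + 1 ∣) q≡1+ℓ+ℓ)
  ... | inj₂ (m , ℓ≡1+m+m) = suc q , |q*-1|≡1+q , (begin
    fromℕ (suc q)                     ≈⟨ fromℕ-suc q ⟩
    1# + fromℕ q                      ≈⟨ solve 1 (λ a → :1 :+ a := a :- :- :1) refl (fromℕ q) ⟩
    fromℕ q - - 1#                    ≈⟨ +-congˡ (-‿cong (χ-nonpower (ℓ-odd⇒ℓ+ℓ-nonpower m ℓ≡1+m+m))) ⟨
    fromℕ q - χ (ℓ ℕ.+ ℓ)             ∎)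
    where
    q%4≡3 : q % 4 ≡ 3
    q%4≡3 = ≡.trans (≡.cong (_% 4) (≡.trans q≡1+ℓ+ℓ (≡.cong (λ l → suc (l ℕ.+ l)) ℓ≡1+m+m)))
                    (≡.trans (≡.cong (_% 4) (4m+3≡ m)) ([m+kn]%n≡m%n 3 m 4))
      where
      4m+3≡ : ∀ m → suc (suc (m ℕ.+ m) ℕ.+ suc (m ℕ.+ m)) ≡ 3 ℕ.+ m ℕ.* 4
      4m+3≡ = solve-∀
    q%4≢1 : ¬ q % 4 ≡ 1
    q%4≢1 q%4≡1 with ≡.trans (≡.sym q%4≡1) q%4≡3
    ... | ()
    |q*-1|≡1+q : ℤ.∣ qStar q ℤ.- + 1 ∣ ≡ suc q
    |q*-1|≡1+q = ≡.trans (≡.cong (λ b → ℤ.∣ (if b then + q else ℤ.- + q) ℤ.- + 1 ∣) (dec-false (q % 4 ℕ.≟ 1) q%4≢1))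
                         (≡.trans (≡.cong (λ n → ℤ.∣ ℤ.- + n ℤ.- + 1 ∣) q≡1+ℓ+ℓ)
                                  (≡.cong suc (≡.trans (≡.cong suc (ℕ.+-identityʳ (ℓ ℕ.+ ℓ))) (≡.sym q≡1+ℓ+ℓ))))

  p∣q*-1⇔q≈χ[ℓ+ℓ] : (+ p) ℤ.∣ (qStar q ℤ.- + 1) ⇔ fromℕ q ≈ χ (ℓ ℕ.+ ℓ)
  p∣q*-1⇔q≈χ[ℓ+ℓ] with n , |q*-1|≡n , n≈q-χ ← |q*-1|≈q-χ[ℓ+ℓ] = mk⇔
    (λ p∣q*-1 → x∙y⁻¹≈ε⇒x≈y _ _ (trans (sym n≈q-χ) (∣⇒fromℕ≈0 (≡.subst (p ∣_) |q*-1|≡n p∣q*-1))))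
    (λ q≈χ → ≡.subst (p ∣_) (≡.sym |q*-1|≡n) (fromℕ≈0⇒∣ (trans n≈q-χ (x≈y⇒x∙y⁻¹≈ε q≈χ))))

  ℓ-period⇔q≈χ[ℓ+ℓ] : PeriodValue (fromℕ ℓ) ⇔ fromℕ q ≈ χ (ℓ ℕ.+ ℓ)
  ℓ-period⇔q≈χ[ℓ+ℓ] = mk⇔
    (λ ℓ-period → *-cancelˡ-nonzero q≉0 (trans (sym (*-cong 2ℓ+1≈q 2ℓ+1≈q)) (trans ℓ-period (*-comm _ _))))
    (λ q≈χ → trans (*-cong 2ℓ+1≈q 2ℓ+1≈q) (*-congʳ q≈χ))
    where
    2ℓ+1≈q : fromℕ ℓ + fromℕ ℓ + 1# ≈ fromℕ q
    2ℓ+1≈q = trans (+-comm _ 1#) (trans (+-congˡ (sym (fromℕ-+ ℓ ℓ))) (sym fromℕ-q))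

  module Periods {c} (c≁0 : ¬ c ~ 0) (c∉P : ¬ IsPower c) {x} (x^q≈1 : x ^ q ≈ 1#) (x≉1 : ¬ x ≈ 1#) where
    open Gauss c≁0 c∉P

    t₁ t₂ : Carrier
    t₁ = trace L p ℓ x
    t₂ = trace L p ℓ (x ^ c)

    nontrivial-trace-period : ∀ {z} → z ^ q ≈ 1# → ¬ z ≈ 1# → PeriodValue (trace L p ℓ z)
    nontrivial-trace-period {z} z^q≈1 z≉1 = trans (*-cong (sym t-s≈2t+1) (sym t-s≈2t+1)) (Primitive.periods-difference² z^q≈1 z≉1)
      where
      t = trace L p ℓ z
      s = trace L p ℓ (z ^ c)
      t-s≈2t+1 : t - s ≈ t + t + 1#
      t-s≈2t+1 = begin
        t - s                          ≈⟨ solve 2 (λ t s → t :- s := (t :+ t :+ :1) :- (t :+ s :+ :1)) refl t s ⟩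
        (t + t + 1#) - (t + s + 1#)    ≈⟨ +-congˡ (-‿cong (+-congʳ (Primitive.periods-sum z^q≈1 z≉1))) ⟩
        (t + t + 1#) - (- 1# + 1#)     ≈⟨ solve 1 (λ u → u :- (:- :1 :+ :1) := u) refl (t + t + 1#) ⟩
        t + t + 1#                     ∎

    t₁+t₂≈-1 : t₁ + t₂ ≈ - 1#
    t₁+t₂≈-1 = Primitive.periods-sum x^q≈1 x≉1

    period⇒t₁∨t₂ : ∀ {t} → PeriodValue t → t ≈ t₁ ⊎ t ≈ t₂
    period⇒t₁∨t₂ {t} t-period = Sum.map (double-injective ∘ +-cancelʳ 1# _ _) (double-injective ∘ +-cancelʳ 1# _ _ ∘ flip trans -[2t₁+1]≈2t₂+1)
      (x²≈y²⇒x≈±y (trans t-period (sym (nontrivial-trace-period x^q≈1 x≉1))))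
      where
      -[2t₁+1]≈2t₂+1 : - (t₁ + t₁ + 1#) ≈ t₂ + t₂ + 1#
      -[2t₁+1]≈2t₂+1 = begin
        - (t₁ + t₁ + 1#)
          ≈⟨ solve 2 (λ a b → :- (a :+ a :+ :1) := (b :+ b :+ :1) :+ (:- (a :+ b) :- (a :+ b) :- :1 :- :1)) refl t₁ t₂ ⟩
        (t₂ + t₂ + 1#) + (- (t₁ + t₂) - (t₁ + t₂) - 1# - 1#)
          ≈⟨ +-congˡ (+-congʳ (+-congʳ (+-cong (-‿cong t₁+t₂≈-1) (-‿cong t₁+t₂≈-1)))) ⟩
        (t₂ + t₂ + 1#) + (- - 1# - - 1# - 1# - 1#)
          ≈⟨ solve 1 (λ u → u :+ (:- :- :1 :- :- :1 :- :1 :- :1) := u) refl (t₂ + t₂ + 1#) ⟩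
        t₂ + t₂ + 1#
          ∎

    t₁≉t₂ : ¬ t₁ ≈ t₂
    t₁≉t₂ t₁≈t₂ = q≉0 (begin
      fromℕ q                           ≈⟨ *-identityˡ _ ⟨
      1# * fromℕ q                      ≈⟨ *-congʳ (χ²≈1 (ℓ ℕ.+ ℓ)) ⟨
      (χ ε * χ ε) * fromℕ q             ≈⟨ *-assoc _ _ _ ⟩
      χ ε * (χ ε * fromℕ q)             ≈⟨ *-congˡ (Primitive.periods-difference² x^q≈1 x≉1) ⟨
      χ ε * ((t₁ - t₂) * (t₁ - t₂))     ≈⟨ *-congˡ (*-cong t₁-t₂≈0 t₁-t₂≈0) ⟩
      χ ε * (0# * 0#)                   ≈⟨ solve 1 (λ e → e :* (:0 :* :0) := :0) refl (χ ε) ⟩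
      0#                                ∎)
      where
      ε = ℓ ℕ.+ ℓ
      t₁-t₂≈0 : t₁ - t₂ ≈ 0#
      t₁-t₂≈0 = x≈y⇒x∙y⁻¹≈ε t₁≈t₂

    t₁∈𝔽ₚ : ∃ λ k → k < p × t₁ ≈ fromℕ k
    t₁∈𝔽ₚ = frobenius-fixed⇒fromℕ (RootOfUnity.trace-fixed x^q≈1)

    t₂∈𝔽ₚ : ∃ λ k → k < p × t₂ ≈ fromℕ k
    t₂∈𝔽ₚ = frobenius-fixed⇒fromℕ (RootOfUnity.trace-fixed (Primitive.x^a^q≈1 x^q≈1 x≉1 c))

    root-trace : ∀ {z} → z ^ q ≈ 1# → trace L p ℓ z ≈ fromℕ ℓ ⊎ trace L p ℓ z ≈ t₁ ⊎ trace L p ℓ z ≈ t₂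
    root-trace {z} z^q≈1 = by-cases (z ≈? 1#)
      where
      by-cases : Dec (z ≈ 1#) → trace L p ℓ z ≈ fromℕ ℓ ⊎ trace L p ℓ z ≈ t₁ ⊎ trace L p ℓ z ≈ t₂
      by-cases (yes z≈1) = inj₁ (trans (trace-cong ℓ z≈1) (trace-1 ℓ))
      by-cases (no  z≉1) = inj₂ (period⇒t₁∨t₂ (nontrivial-trace-period z^q≈1 z≉1))

    InT : ℕ → Set
    InT k = Any (λ z → (pow L z q ≈ 1#) × (trace L p ℓ z ≈ natL L k)) elems

    InT-intro : ∀ {z k} → z ^ q ≈ 1# → trace L p ℓ z ≈ fromℕ k → InT k
    InT-intro {z} {k} z^q≈1 tz≈k = Any.map (λ {e} z≈e →
        trans (reflexive (pow≡^ e q)) (trans (^-congˡ q (sym z≈e)) z^q≈1)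
      , trans (trace-cong ℓ (sym z≈e)) (trans tz≈k (sym (natL≈fromℕ k)))) (complete z)

    InT-elim : ∀ {k} → InT k → ∃ λ z → z ^ q ≈ 1# × trace L p ℓ z ≈ fromℕ k
    InT-elim {k} z∈T = let z , pow-z-q≈1 , tz≈k = Any.satisfied z∈T in
      z , trans (reflexive (≡.sym (pow≡^ z q))) pow-z-q≈1 , trans tz≈k (natL≈fromℕ k)

    module Values {k₁ k₂} (k₁<p : k₁ < p) (t₁≈k₁ : t₁ ≈ fromℕ k₁) (k₂<p : k₂ < p) (t₂≈k₂ : t₂ ≈ fromℕ k₂) where

      k₀ : ℕ
      k₀ = ℓ % p

      k₀<p : k₀ < p
      k₀<p = m%n<n ℓ p

      trace-value : ∀ {z k} → k < p → z ^ q ≈ 1# → trace L p ℓ z ≈ fromℕ k → k ≡ k₀ ⊎ k ≡ k₁ ⊎ k ≡ k₂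
      trace-value {z} {k} k<p z^q≈1 tz≈k =
        Sum.map (λ tz≈ℓ → injective k₀<p (trans tz≈ℓ (fromℕ-mod ℓ)))
                (Sum.map (λ tz≈t₁ → injective k₁<p (trans tz≈t₁ t₁≈k₁)) (λ tz≈t₂ → injective k₂<p (trans tz≈t₂ t₂≈k₂)))
                (root-trace z^q≈1)
        where
        injective : ∀ {j} → j < p → trace L p ℓ z ≈ fromℕ j → k ≡ j
        injective j<p tz≈j = fromℕ-injective k<p j<p (trans (sym tz≈k) tz≈j)

      InT⇒k₀∨k₁∨k₂ : ∀ {k} → k < p → InT k → k ≡ k₀ ⊎ k ≡ k₁ ⊎ k ≡ k₂
      InT⇒k₀∨k₁∨k₂ {k} k<p k∈T = let z , z^q≈1 , tz≈k = InT-elim {k} k∈T in trace-value k<p z^q≈1 tz≈k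

      k₀∈T : InT k₀
      k₀∈T = InT-intro {k = k₀} (1^n≈1 q) (trans (trace-1 ℓ) (fromℕ-mod ℓ))

      k₁∈T : InT k₁
      k₁∈T = InT-intro {k = k₁} x^q≈1 t₁≈k₁

      k₂∈T : InT k₂
      k₂∈T = InT-intro {k = k₂} (Primitive.x^a^q≈1 x^q≈1 x≉1 c) t₂≈k₂

      k₁≢k₂ : ¬ k₁ ≡ k₂
      k₁≢k₂ k₁≡k₂ = t₁≉t₂ (trans t₁≈k₁ (trans (reflexive (≡.cong fromℕ k₁≡k₂)) (sym t₂≈k₂)))

      k₀∈[k₁,k₂]⇔ℓ-period : (k₀ ≡ k₁ ⊎ k₀ ≡ k₂) ⇔ PeriodValue (fromℕ ℓ)
      k₀∈[k₁,k₂]⇔ℓ-period = mk⇔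
        [ (λ k₀≡k₁ → PeriodValue-resp (ℓ≈ k₀≡k₁ t₁≈k₁) (nontrivial-trace-period x^q≈1 x≉1))
        , (λ k₀≡k₂ → PeriodValue-resp (ℓ≈ k₀≡k₂ t₂≈k₂) (nontrivial-trace-period (Primitive.x^a^q≈1 x^q≈1 x≉1 c) (Primitive.x^a≉1 x^q≈1 x≉1 c≁0))) ]′
        (Sum.map (λ ℓ≈t₁ → k₀≡ k₁<p (trans ℓ≈t₁ t₁≈k₁)) (λ ℓ≈t₂ → k₀≡ k₂<p (trans ℓ≈t₂ t₂≈k₂)) ∘ period⇒t₁∨t₂)
        where
        ℓ≈ : ∀ {j t} → k₀ ≡ j → t ≈ fromℕ j → fromℕ ℓ ≈ t
        ℓ≈ k₀≡j t≈j = trans (fromℕ-mod ℓ) (trans (reflexive (≡.cong fromℕ k₀≡j)) (sym t≈j))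
        k₀≡ : ∀ {j} → j < p → fromℕ ℓ ≈ fromℕ j → k₀ ≡ j
        k₀≡ j<p ℓ≈j = fromℕ-injective k₀<p j<p (trans (sym (fromℕ-mod ℓ)) ℓ≈j)

      cardT≡2 : k₀ ≡ k₁ ⊎ k₀ ≡ k₂ → cardT L p ℓ q ≡ 2
      cardT≡2 k₀∈[k₁,k₂] = length-filter-upTo (inT? L p ℓ q) p ((k₁≢k₂ ∷ []) ∷ [] ∷ []) into from
        where
        into : ∀ {k} → k < p → InT k → k ∈ k₁ ∷ k₂ ∷ []
        into k<p k∈T = [ (λ k≡k₀ → [ here ∘ ≡.trans k≡k₀ , there ∘ here ∘ ≡.trans k≡k₀ ]′ k₀∈[k₁,k₂]) , [ here , there ∘ here ]′ ]′
                         (InT⇒k₀∨k₁∨k₂ k<p k∈T)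
        from : ∀ {k} → k ∈ k₁ ∷ k₂ ∷ [] → k < p × InT k
        from (here ≡.refl)         = k₁<p , k₁∈T
        from (there (here ≡.refl)) = k₂<p , k₂∈T

      cardT≡3 : ¬ (k₀ ≡ k₁ ⊎ k₀ ≡ k₂) → cardT L p ℓ q ≡ 3
      cardT≡3 k₀∉[k₁,k₂] =
        length-filter-upTo (inT? L p ℓ q) p (((k₀∉[k₁,k₂] ∘ inj₁) ∷ (k₀∉[k₁,k₂] ∘ inj₂) ∷ []) ∷ (k₁≢k₂ ∷ []) ∷ [] ∷ []) into from
        where
        into : ∀ {k} → k < p → InT k → k ∈ k₀ ∷ k₁ ∷ k₂ ∷ []
        into k<p k∈T = [ here , [ there ∘ here , there ∘ there ∘ here ]′ ]′ (InT⇒k₀∨k₁∨k₂ k<p k∈T)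
        from : ∀ {k} → k ∈ k₀ ∷ k₁ ∷ k₂ ∷ [] → k < p × InT k
        from (here ≡.refl)                 = k₀<p , k₀∈T
        from (there (here ≡.refl))         = k₁<p , k₁∈T
        from (there (there (here ≡.refl))) = k₂<p , k₂∈T

open import Defs
open import Data.Nat using (ℕ; suc; _^_; _%_; _∸_; _*_; _+_; _<_)
open import Data.Nat.Primality using (Prime)
open import Data.Nat.Divisibility as ℕ∣ using ()
open import Data.Integer as ℤ using (+_)
open import Data.Integer.Divisibility using (_∣_)
open import Data.Product using (_×_)
open import Relation.Nullary using (¬_)
open import Relation.Binary.PropositionalEquality using (_≡_)

open import Data.Nat.Primality using (prime⇒nonZero)
open import Data.Product using (_,_)
open import Function using (_∘_; Equivalence)
import Relation.Binary.PropositionalEquality as ≡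
open PrimeBinomial using (prime⇒1<p)

proposition6p5 : (p q ℓ : ℕ) → Prime p → Prime q → p % 2 ≡ 1 → q % 2 ≡ 1 →
    -- ℓ = (q-1)/2 is the multiplicative order of p modulo q
    2 * ℓ + 1 ≡ q →
    q ℕ∣.∣ (p ^ ℓ ∸ 1) →
    (∀ k → 0 < k → k < ℓ → ¬ (q ℕ∣.∣ (p ^ k ∸ 1))) →
    -- L is a finite field with p^ℓ elements
    (L : FiniteField) → card L ≡ p ^ ℓ →
    ((+ p) ∣ (qStar q ℤ.- + 1) → cardT L p ℓ q ≡ 2)
    × (¬ ((+ p) ∣ (qStar q ℤ.- + 1)) → cardT L p ℓ q ≡ 3)
proposition6p5 p q ℓ p-prime q-prime p-odd _ q≡2ℓ+1 q∣pˡ-1 minimal L |L|≡pˡ =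
  let p-order : MultiplicativeOrder p q ℓ
      p-order = record { q∣pˡ-1 = q∣pˡ-1 ; minimal = minimal }
      open TraceSet L p q ℓ p-prime p-odd q-prime q≡2ℓ+1 p-order |L|≡pˡ
      x , x^q≈1 , x≉1 = FiniteFieldProperties.nontrivial-root-of-unity L (prime⇒1<p q-prime)
                          (≡.subst (λ n → q ℕ∣.∣ n ∸ 1) (≡.sym |L|≡pˡ) q∣pˡ-1)
      c , c≁0 , c∉P = Residues.nonpower-exists p q ℓ {{prime⇒nonZero p-prime}} q-prime q≡2ℓ+1 p-order
      open Periods c≁0 c∉P x^q≈1 x≉1
      k₁ , k₁<p , t₁≈k₁ = t₁∈𝔽ₚ
      k₂ , k₂<p , t₂≈k₂ = t₂∈𝔽ₚ
      open Values k₁<p t₁≈k₁ k₂<p t₂≈k₂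
      open Equivalence
  in  cardT≡2 ∘ from k₀∈[k₁,k₂]⇔ℓ-period ∘ from ℓ-period⇔q≈χ[ℓ+ℓ] ∘ to p∣q*-1⇔q≈χ[ℓ+ℓ]
    , λ p∤q*-1 → cardT≡3 (p∤q*-1 ∘ from p∣q*-1⇔q≈χ[ℓ+ℓ] ∘ to ℓ-period⇔q≈χ[ℓ+ℓ] ∘ to k₀∈[k₁,k₂]⇔ℓ-period)
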